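{- Let $a,b\in\mathbb{Z}[i]\setminus\{0\}$ have Gauss remainder $r\neq0$, and suppose $\phi_{\mathbb{Z}[i]}(r)\geq\phi_{\mathbb{Z}[i]}(b)=n$ and $2^{v_2(r)}\nmid w_{n-1}$. Then $m(r)=0$ and $\phi_{\mathbb{Z}[i]}\left(r-\frac{u_b}{u_r}b\right)<\phi_{\mathbb{Z}[i]}(b)$.
   Context: $\mathbb{Z}[i]$ has units $\pm1,\pm i$ and norm $\mathrm{Nm}(x+yi)=x^2+y^2$. A function $f:\mathbb{Z}[i]\setminus\{0\}\to W$ ($W$ a well-ordered set having $\mathbb{N}$ as an initial segment) is Euclidean if for all nonzero $a,b$ there exist $q,r$ with $a=qb+r$ and either $r=0$ or $f(r)<f(b)$. $\phi_{\mathbb{Z}[i]}$ is the minimal Euclidean function, the pointwise minimum of all Euclidean functions (equivalently, the minimal $n$ such that $z=\sum_{j=0}^n u_j(1+i)^j$ with $u_j\in\{0,\pm1,\pm i\}$, $u_n\ne0$). Gauss remainder: write $a\bar b/\mathrm{Nm}(b)=\alpha+\beta i$; let $\lfloor x\rceil=\lfloor x\rfloor$ if $0\le x-\lfloor x\rfloor\le1/2$ and $\lceil x\rceil$ otherwise; $q=\lfloor\alpha\rceil+\lfloor\beta\rceil i$ and $r=a-qb$. $\ell_\infty(x+yi)=\max(|x|,|y|)$, $m(x+yi)=\min(|x|,|y|)$. For $z\ne0$, $u_z$ is the unique unit with $\Re(u_z z)=\ell_\infty(z)$ if $\ell_\infty(z)\ne m(z)$, and the unique unit with $u_z z=\ell_\infty(z)(1+i)$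 if $\ell_\infty(z)=m(z)$. $v_2(z)$ is the largest $j$ with $2^j\mid z$ in $\mathbb{Z}[i]$. For integers $k$, $w_{2k}=3\cdot2^k$, $w_{2k+1}=4\cdot2^k$ ($w_0=3,w_1=4,w_2=6,\dots$). -}

module Defs where

open import Data.Nat as ℕ using (ℕ; zero; suc; _⊔_; _⊓_)
open import Data.Integer as ℤ using (ℤ; +_; ∣_∣; _/ℕ_; _%ℕ_)
open import Data.Bool using (if_then_else_)
open import Data.Vec using (Vec; []; _∷_; last)
open import Data.Vec.Relation.Unary.All using (All)
open import Data.Product using (Σ; _×_)
open import Relation.Binary.PropositionalEquality using (_≡_; _≢_)
open import Relation.Nullary using (¬_; does)

record 𝔾 : Set where
  constructor _+_i
  field
    re : ℤ
    im : ℤ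
open 𝔾 public

infixl 6 _+ᵍ_ _-ᵍ_
infixl 7 _*ᵍ_
infixr 8 _^ᵍ_
infix 4 _∣ᵍ_

0ᵍ 1ᵍ iᵍ 1+i : 𝔾
0ᵍ  = (+ 0) + (+ 0) i
1ᵍ  = (+ 1) + (+ 0) i
iᵍ  = (+ 0) + (+ 1) i
1+i = (+ 1) + (+ 1) i

-ᵍ_ : 𝔾 → 𝔾
-ᵍ (x + y i) = (ℤ.- x) + (ℤ.- y) i

_+ᵍ_ : 𝔾 → 𝔾 → 𝔾
(a + b i) +ᵍ (c + d i) = (a ℤ.+ c) + (b ℤ.+ d) i

_-ᵍ_ : 𝔾 → 𝔾 → 𝔾
z -ᵍ w = z +ᵍ (-ᵍ w)

_*ᵍ_ : 𝔾 → 𝔾 → 𝔾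
(a + b i) *ᵍ (c + d i) = (a ℤ.* c ℤ.- b ℤ.* d) + (a ℤ.* d ℤ.+ b ℤ.* c) i

conj : 𝔾 → 𝔾
conj (x + y i) = x + (ℤ.- y) i

fromℤ : ℤ → 𝔾
fromℤ n = n + (+ 0) i

fromℕ : ℕ → 𝔾
fromℕ n = fromℤ (+ n)

_^ᵍ_ : 𝔾 → ℕ → 𝔾
z ^ᵍ zero  = 1ᵍ
z ^ᵍ suc n = z *ᵍ (z ^ᵍ n)

Nm : 𝔾 → ℕ
Nm (x + y i) = ∣ x ℤ.* x ℤ.+ y ℤ.* y ∣

_∣ᵍ_ : 𝔾 → 𝔾 → Set
d ∣ᵍ z = Σ 𝔾 (λ c → c *ᵍ d ≡ z)

data IsUnit : 𝔾 → Set where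
  u1  : IsUnit ((+ 1) + (+ 0) i)
  u-1 : IsUnit ((ℤ.- (+ 1)) + (+ 0) i)
  ui  : IsUnit ((+ 0) + (+ 1) i)
  u-i : IsUnit ((+ 0) + (ℤ.- (+ 1)) i)

data IsDigit : 𝔾 → Set where
  d0 : IsDigit 0ᵍ
  du : ∀ {u} → IsUnit u → IsDigit u

ℓ∞ : 𝔾 → ℕ
ℓ∞ (x + y i) = ∣ x ∣ ⊔ ∣ y ∣

mᵍ : 𝔾 → ℕ
mᵍ (x + y i) = ∣ x ∣ ⊓ ∣ y ∣

-- Minimal Euclidean function φ_{ℤ[i]}, via the (1+i)-adic expansion:
-- φ(z) = least n with z = Σ_{j=0}^n u_j (1+i)^j, u_j ∈ {0,±1,±i}, u_n ≠ 0.

evalExp : ∀ {k} → Vec 𝔾 k → 𝔾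
evalExp []       = 0ᵍ
evalExp (u ∷ us) = u +ᵍ 1+i *ᵍ evalExp us

HasExp : 𝔾 → ℕ → Set
HasExp z n = Σ (Vec 𝔾 (suc n)) λ us →
  All IsDigit us × (last us ≢ 0ᵍ) × (evalExp us ≡ z)

IsPhi : 𝔾 → ℕ → Set
IsPhi z n = HasExp z n × (∀ k → k ℕ.< n → ¬ HasExp z k)

IsV2 : 𝔾 → ℕ → Set
IsV2 z j = (fromℕ 2 ^ᵍ j ∣ᵍ z) × ¬ (fromℕ 2 ^ᵍ suc j ∣ᵍ z)

IsUz : 𝔾 → 𝔾 → Set
IsUz z u = IsUnit u
  × (ℓ∞ z ≢ mᵍ z → re (u *ᵍ z) ≡ + ℓ∞ z)
  × (ℓ∞ z ≡ mᵍ z → u *ᵍ z ≡ fromℕ (ℓ∞ z) *ᵍ 1+i)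

-- w_{2k} = 3·2^k, w_{2k+1} = 4·2^k  (k ∈ ℤ; only k ≥ -1 needed)
w : ℕ → ℕ
w zero          = 3
w (suc zero)    = 4
w (suc (suc n)) = 2 ℕ.* w n

-- wPred n = w_{n-1}; for n = 0 this is w_{-1} = 4·2^{-1} = 2
wPred : ℕ → ℕ
wPred zero    = 2
wPred (suc n) = w n

-- Gauss remainder.
-- roundDiv p N = ⌊ p / N ⌉ : floor if the fractional part is ≤ 1/2,
-- ceiling otherwise.  (N = 0 never occurs for b ≠ 0; junk value 0.)
roundDiv : ℤ → ℕ → ℤ
roundDiv p zero    = + 0
roundDiv p (suc k) =
  if does ((2 ℕ.* (p %ℕ suc k)) ℕ.≤? suc k)
  then p /ℕ suc k
  else (p /ℕ suc k) ℤ.+ (+ 1)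

gaussQuot : 𝔾 → 𝔾 → 𝔾
gaussQuot a b = roundDiv (re (a *ᵍ conj b)) (Nm b) + roundDiv (im (a *ᵍ conj b)) (Nm b) i

gaussRem : 𝔾 → 𝔾 → 𝔾
gaussRem a b = a -ᵍ gaussQuot a b *ᵍ b

{-# OPTIONS --safe #-}
module Submission where

-- Write r = c 2^v with c not divisible by 2. The elements with φ(z) ≤ n are 0, the elements
-- not divisible by 2 in the octagon |x|, |y| ≤ w n - 2, |x| + |y| ≤ w (n + 1) - 3, and twice
-- those with φ(z) ≤ n - 2; in particular N(b) < w n · w (n + 1). Rounding the Gauss quotient
-- bounds both coordinates of r b̄ by N(b) / 2, so 2 · 4^v N(c) = 2 N(r) ≤ N(b). As
-- 2^v ∤ w (n - 1), this leaves only n = 2k + 1, v = k + 1 and N(c) ≤ 2, and c = (1 + i) · unit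
-- violates the coordinate bounds in the diagonal directions. So r = u 2^(k+1) for a unit u,
-- whence m(r) = 0 and r - (u_b / u_r) b = ū_r (2^(k+1) - u_b b). Writing u_b b = ℓ∞(b) + Y i,
-- the remainder bound gives ℓ∞(b) ≥ 2^(k+1), and subtracting 2^(k+1) moves u_b b from the
-- octagon of level 2k + 1 into the one of level 2k.

open import Defs
open import Data.Bool using (if_then_else_)
open import Data.Empty using (⊥; ⊥-elim)
open import Data.Integer as ℤ using (ℤ; +_; -[1+_]; 0ℤ; +≤+; -≤-; -≤+; _≤_; _<_; _+_; _*_; _-_; -_)
import Data.Integer.DivMod as ℤD
import Data.Integer.Properties as ℤP
open import Data.Integer.Tactic.RingSolver using (solve)
open import Data.List using (_∷_; [])
open import Data.Nat as ℕ using (ℕ; zero; suc; z≤n; s≤s)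
import Data.Nat.Properties as ℕP
open import Data.Product using (Σ; _×_; _,_; proj₁; proj₂)
open import Data.Sum using (_⊎_; inj₁; inj₂; [_,_]′)
open import Data.Unit using (tt)
import Data.Vec as V
import Data.Vec.Relation.Unary.All as All
open import Relation.Binary.PropositionalEquality
open import Relation.Nullary using (¬_; Dec; yes; no; does)
import Relation.Nullary.Decidable as Dec

-- Linear and polynomial inequalities are proved by certificate: x ≤ y follows
-- from an expression of y - x as a sum of products of known nonnegatives,
-- the identity being checked by the ring solver.
≤-by : ∀ {x y} g → 0ℤ ≤ g → y - x ≡ g → x ≤ y
≤-by g 0≤g y-x≡g = ℤP.0≤i-j⇒j≤i (subst (0ℤ ≤_) (sym y-x≡g) 0≤g)

gap : ∀ {x y} → x ≤ y → 0ℤ ≤ y - x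
gap = ℤP.i≤j⇒0≤j-i

infixl 6 _⊕_
infixl 7 _⊗_

_⊕_ : ∀ {a b} → 0ℤ ≤ a → 0ℤ ≤ b → 0ℤ ≤ a + b
_⊕_ = ℤP.+-mono-≤

_⊗_ : ∀ {a b} → 0ℤ ≤ a → 0ℤ ≤ b → 0ℤ ≤ a * b
_⊗_ {a} {b} 0≤a 0≤b =
  subst (_≤ a * b) (ℤP.*-zeroʳ a) (ℤP.*-monoˡ-≤-nonNeg a {{ℤ.nonNegative 0≤a}} 0≤b)

0≤+ : ∀ k → 0ℤ ≤ + k
0≤+ k = +≤+ z≤n

nonneg+1≢0 : ∀ g → 0ℤ ≤ g → g + + 1 ≢ 0ℤ
nonneg+1≢0 g 0≤g g+1≡0 = +1≰0 (≤-by g 0≤g (trans (cong (_- + 1) (sym g+1≡0)) (solve (g ∷ []))))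
  where
  +1≰0 : ¬ (+ 1 ≤ 0ℤ)
  +1≰0 (+≤+ ())

<⇒+1≤ : ∀ {a b} → a < b → a + + 1 ≤ b
<⇒+1≤ {a} {b} a<b = subst (_≤ b) (ℤP.+-comm (+ 1) a) (ℤP.i<j⇒suc[i]≤j a<b)

≰⇒+1≤ : ∀ {a b} → ¬ (a ≤ b) → b + + 1 ≤ a
≰⇒+1≤ a≰b = <⇒+1≤ (ℤP.≰⇒> a≰b)

double-cancel-≤ : ∀ a t → a + a ≤ t + t → a ≤ t
double-cancel-≤ a t h with a ℤ.≤? t
... | yes a≤t = a≤t
... | no a≰t = ⊥-elim (nonneg+1≢0 _ (gap t<a ⊕ gap t<a ⊕ gap h ⊕ 0≤+ 1) (solve (a ∷ t ∷ [])))
  where t<a = ≰⇒+1≤ a≰t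

double-injective : ∀ a t → a + a ≡ t + t → a ≡ t
double-injective a t eq =
  ℤP.≤-antisym (double-cancel-≤ a t (ℤP.≤-reflexive eq)) (double-cancel-≤ t a (ℤP.≤-reflexive (sym eq)))

halve-+3≤ : ∀ a B → a + a + + 3 ≤ B + B → a + + 2 ≤ B
halve-+3≤ a B h with a + + 2 ℤ.≤? B
... | yes a+2≤B = a+2≤B
... | no a+2≰B = ⊥-elim (nonneg+1≢0 _ (gap h ⊕ gap B<a+2 ⊕ gap B<a+2) (solve (a ∷ B ∷ [])))
  where B<a+2 = ≰⇒+1≤ a+2≰B

*-cancelˡ-≤-≥1 : ∀ N A B → + 1 ≤ N → N * A ≤ N * B → A ≤ B
*-cancelˡ-≤-≥1 N A B 1≤N = ℤP.*-cancelˡ-≤-pos A B N {{ℤ.positive (ℤP.suc[i]≤j⇒i<j 1≤N)}}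

Even Odd : ℤ → Set
Even x = Σ ℤ λ t → x ≡ t + t
Odd x = Σ ℤ λ t → x ≡ t + t + + 1

parity-+ : ∀ n → Even (+ n) ⊎ Odd (+ n)
parity-+ zero = inj₁ (0ℤ , refl)
parity-+ (suc n) with parity-+ n
... | inj₁ (t , eq) = inj₂ (t , trans (ℤP.pos-+ 1 n) (trans (ℤP.+-comm (+ 1) (+ n)) (cong (_+ + 1) eq)))
... | inj₂ (t , eq) = inj₁ (t + + 1 , trans (ℤP.pos-+ 1 n)
                          (trans (ℤP.+-comm (+ 1) (+ n)) (trans (cong (_+ + 1) eq) (solve (t ∷ [])))))

parity : ∀ x → Even x ⊎ Odd x
parity (+ n) = parity-+ n
parity -[1+ n ] with parity-+ (suc n)
... | inj₁ (t , eq) = inj₁ (- t , trans (cong -_ eq) (solve (t ∷ [])))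
... | inj₂ (t , eq) = inj₂ (- t - + 1 , trans (cong -_ eq) (solve (t ∷ [])))

even⇒¬odd : ∀ {x} → Even x → ¬ Odd x
even⇒¬odd {x} (t , x≡t+t) (s , x≡s+s+1) with t ℤ.≤? s
... | yes t≤s = nonneg+1≢0 _ (gap t≤s ⊕ gap t≤s) (begin
  (s - t) + (s - t) + + 1  ≡⟨ solve (s ∷ t ∷ []) ⟩
  (s + s + + 1) - (t + t)  ≡⟨ cong₂ _-_ (sym x≡s+s+1) (sym x≡t+t) ⟩
  x - x                    ≡⟨ ℤP.+-inverseʳ x ⟩
  0ℤ                       ∎)
  where open ≡-Reasoning
... | no t≰s = nonneg+1≢0 _ (gap s<t ⊕ gap s<t) (begin
  (t - (s + + 1)) + (t - (s + + 1)) + + 1  ≡⟨ solve (s ∷ t ∷ []) ⟩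
  (t + t) - (s + s + + 1)                  ≡⟨ cong₂ _-_ (sym x≡t+t) (sym x≡s+s+1) ⟩
  x - x                                    ≡⟨ ℤP.+-inverseʳ x ⟩
  0ℤ                                       ∎)
  where open ≡-Reasoning
        s<t = ≰⇒+1≤ t≰s

even+even : ∀ {a b} → Even a → Even b → Even (a + b)
even+even {a} {b} (s , refl) (t , refl) = s + t , solve (s ∷ t ∷ [])

even+odd : ∀ {a b} → Even a → Odd b → Odd (a + b)
even+odd {a} {b} (s , refl) (t , refl) = s + t , solve (s ∷ t ∷ [])

odd+even : ∀ {a b} → Odd a → Even b → Odd (a + b)
odd+even {a} {b} (s , refl) (t , refl) = s + t , solve (s ∷ t ∷ [])

odd+odd : ∀ {a b} → Odd a → Odd b → Even (a + b)
odd+odd {a} {b} (s , refl) (t , refl) = s + t + + 1 , solve (s ∷ t ∷ [])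

even-neg : ∀ {a} → Even a → Even (- a)
even-neg (s , refl) = - s , solve (s ∷ [])

odd-neg : ∀ {a} → Odd a → Odd (- a)
odd-neg (s , refl) = - s - + 1 , solve (s ∷ [])

even-neg⁻¹ : ∀ {a} → Even (- a) → Even a
even-neg⁻¹ {a} e = subst Even (ℤP.neg-involutive a) (even-neg e)

odd+2≤even⇒+3≤ : ∀ t B → Odd t → Even B → t + + 2 ≤ B → t + + 3 ≤ B
odd+2≤even⇒+3≤ t B (s , refl) (r , refl) t+2≤B =
  subst (_≤ r + r) +2+1≡+3 (<⇒+1≤ (ℤP.≤∧≢⇒< t+2≤B t+2≢B))
  where
  +2+1≡+3 : s + s + + 1 + + 2 + + 1 ≡ s + s + + 1 + + 3
  +2+1≡+3 = solve (s ∷ [])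
  t+2≢B : s + s + + 1 + + 2 ≢ r + r
  t+2≢B eq = even⇒¬odd (r , refl) (s + + 1 , trans (sym eq) (solve (s ∷ [])))

W : ℕ → ℤ
W n = + w n

W-suc-suc : ∀ m → W (suc (suc m)) ≡ W m + W m
W-suc-suc m = trans (cong (λ k → + (w m ℕ.+ k)) (ℕP.+-identityʳ (w m))) (ℤP.pos-+ (w m) (w m))

W-suc-even : ∀ m → Even (W (suc m))
W-suc-even zero = + 2 , refl
W-suc-even (suc m) = W m , W-suc-suc m

w<w-suc : ∀ m → w m ℕ.< w (suc m)
w<w-suc zero = ℕP.≤-refl
w<w-suc (suc zero) = ℕP.n≤1+n 5
w<w-suc (suc (suc m)) = ℕP.*-monoʳ-< 2 (w<w-suc m)

W+1≤W-suc : ∀ m → W m + + 1 ≤ W (suc m)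
W+1≤W-suc m = subst (_≤ W (suc m)) (trans (cong +_ (ℕP.+-comm 1 (w m))) (ℤP.pos-+ (w m) 1)) (+≤+ (w<w-suc m))

3≤w : ∀ m → 3 ℕ.≤ w m
3≤w zero = ℕP.≤-refl
3≤w (suc m) = ℕP.≤-trans (3≤w m) (ℕP.<⇒≤ (w<w-suc m))

3≤W : ∀ m → + 3 ≤ W m
3≤W m = +≤+ (3≤w m)

4≤W-suc : ∀ m → + 4 ≤ W (suc m)
4≤W-suc m = +≤+ (ℕP.≤-trans (s≤s (3≤w m)) (w<w-suc m))

-1ᵍ -iᵍ : 𝔾
-1ᵍ = (- + 1) + (+ 0) i
-iᵍ = (+ 0) + (- + 1) i

*ᵍ-identityˡ : ∀ z → 1ᵍ *ᵍ z ≡ z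
*ᵍ-identityˡ (x + y i) = cong₂ _+_i (solve (x ∷ y ∷ [])) (solve (x ∷ y ∷ []))

*ᵍ-identityʳ : ∀ z → z *ᵍ 1ᵍ ≡ z
*ᵍ-identityʳ (x + y i) = cong₂ _+_i (solve (x ∷ y ∷ [])) (solve (x ∷ y ∷ []))

*ᵍ-zeroʳ : ∀ z → z *ᵍ 0ᵍ ≡ 0ᵍ
*ᵍ-zeroʳ (x + y i) = cong₂ _+_i (solve (x ∷ y ∷ [])) (solve (x ∷ y ∷ []))

+ᵍ-identityˡ : ∀ z → 0ᵍ +ᵍ z ≡ z
+ᵍ-identityˡ (x + y i) = cong₂ _+_i (ℤP.+-identityˡ x) (ℤP.+-identityˡ y)

+ᵍ-identityʳ-1+i*0 : ∀ z → z +ᵍ 1+i *ᵍ 0ᵍ ≡ z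
+ᵍ-identityʳ-1+i*0 (x + y i) = cong₂ _+_i (ℤP.+-identityʳ x) (ℤP.+-identityʳ y)

-1*ᵍ : ∀ x y → -1ᵍ *ᵍ (x + y i) ≡ (- x) + (- y) i
-1*ᵍ x y = cong₂ _+_i (solve (x ∷ y ∷ [])) (solve (x ∷ y ∷ []))

i*ᵍ : ∀ x y → iᵍ *ᵍ (x + y i) ≡ (- y) + x i
i*ᵍ x y = cong₂ _+_i (solve (x ∷ y ∷ [])) (solve (x ∷ y ∷ []))

-i*ᵍ : ∀ x y → -iᵍ *ᵍ (x + y i) ≡ y + (- x) i
-i*ᵍ x y = cong₂ _+_i (solve (x ∷ y ∷ [])) (solve (x ∷ y ∷ []))

*ᵍ-assoc : ∀ a b c → a *ᵍ (b *ᵍ c) ≡ (a *ᵍ b) *ᵍ c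
*ᵍ-assoc (a₁ + a₂ i) (b₁ + b₂ i) (c₁ + c₂ i) = cong₂ _+_i re-eq im-eq
  where
  re-eq : a₁ * (b₁ * c₁ - b₂ * c₂) - a₂ * (b₁ * c₂ + b₂ * c₁) ≡ (a₁ * b₁ - a₂ * b₂) * c₁ - (a₁ * b₂ + a₂ * b₁) * c₂
  re-eq = solve (a₁ ∷ a₂ ∷ b₁ ∷ b₂ ∷ c₁ ∷ c₂ ∷ [])
  im-eq : a₁ * (b₁ * c₂ + b₂ * c₁) + a₂ * (b₁ * c₁ - b₂ * c₂) ≡ (a₁ * b₁ - a₂ * b₂) * c₂ + (a₁ * b₂ + a₂ * b₁) * c₁
  im-eq = solve (a₁ ∷ a₂ ∷ b₁ ∷ b₂ ∷ c₁ ∷ c₂ ∷ [])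

*ᵍ-comm-1+i : ∀ v z → v *ᵍ (1+i *ᵍ z) ≡ 1+i *ᵍ (v *ᵍ z)
*ᵍ-comm-1+i (v₁ + v₂ i) (z₁ + z₂ i) = cong₂ _+_i re-eq im-eq
  where
  re-eq : v₁ * (+ 1 * z₁ - + 1 * z₂) - v₂ * (+ 1 * z₂ + + 1 * z₁) ≡ + 1 * (v₁ * z₁ - v₂ * z₂) - + 1 * (v₁ * z₂ + v₂ * z₁)
  re-eq = solve (v₁ ∷ v₂ ∷ z₁ ∷ z₂ ∷ [])
  im-eq : v₁ * (+ 1 * z₂ + + 1 * z₁) + v₂ * (+ 1 * z₁ - + 1 * z₂) ≡ + 1 * (v₁ * z₂ + v₂ * z₁) + + 1 * (v₁ * z₁ - v₂ * z₂)
  im-eq = solve (v₁ ∷ v₂ ∷ z₁ ∷ z₂ ∷ [])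

*ᵍ-distribˡ-+ᵍ : ∀ a b c → a *ᵍ (b +ᵍ c) ≡ a *ᵍ b +ᵍ a *ᵍ c
*ᵍ-distribˡ-+ᵍ (a₁ + a₂ i) (b₁ + b₂ i) (c₁ + c₂ i) = cong₂ _+_i re-eq im-eq
  where
  re-eq : a₁ * (b₁ + c₁) - a₂ * (b₂ + c₂) ≡ (a₁ * b₁ - a₂ * b₂) + (a₁ * c₁ - a₂ * c₂)
  re-eq = solve (a₁ ∷ a₂ ∷ b₁ ∷ b₂ ∷ c₁ ∷ c₂ ∷ [])
  im-eq : a₁ * (b₂ + c₂) + a₂ * (b₁ + c₁) ≡ (a₁ * b₂ + a₂ * b₁) + (a₁ * c₂ + a₂ * c₁)
  im-eq = solve (a₁ ∷ a₂ ∷ b₁ ∷ b₂ ∷ c₁ ∷ c₂ ∷ [])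

*ᵍ-distrib-digit : ∀ v d z → v *ᵍ (d +ᵍ 1+i *ᵍ z) ≡ v *ᵍ d +ᵍ 1+i *ᵍ (v *ᵍ z)
*ᵍ-distrib-digit v d z = trans (*ᵍ-distribˡ-+ᵍ v d (1+i *ᵍ z)) (cong (v *ᵍ d +ᵍ_) (*ᵍ-comm-1+i v z))

IsUnit-* : ∀ {u v} → IsUnit u → IsUnit v → IsUnit (u *ᵍ v)
IsUnit-* u1 u1 = u1
IsUnit-* u1 u-1 = u-1
IsUnit-* u1 ui = ui
IsUnit-* u1 u-i = u-i
IsUnit-* u-1 u1 = u-1
IsUnit-* u-1 u-1 = u1
IsUnit-* u-1 ui = u-i
IsUnit-* u-1 u-i = ui
IsUnit-* ui u1 = ui
IsUnit-* ui u-1 = u-i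
IsUnit-* ui ui = u-1
IsUnit-* ui u-i = u1
IsUnit-* u-i u1 = u-i
IsUnit-* u-i u-1 = ui
IsUnit-* u-i ui = u1
IsUnit-* u-i u-i = u-1

IsUnit-conj : ∀ {u} → IsUnit u → IsUnit (conj u)
IsUnit-conj u1 = u1
IsUnit-conj u-1 = u-1
IsUnit-conj ui = u-i
IsUnit-conj u-i = ui

conj-unit-inverse : ∀ {u} → IsUnit u → conj u *ᵍ u ≡ 1ᵍ
conj-unit-inverse u1 = refl
conj-unit-inverse u-1 = refl
conj-unit-inverse ui = refl
conj-unit-inverse u-i = refl

unit-cancel : ∀ {v} → IsUnit v → ∀ z → conj v *ᵍ (v *ᵍ z) ≡ z
unit-cancel {v} v-unit z = begin
  conj v *ᵍ (v *ᵍ z)  ≡⟨ *ᵍ-assoc (conj v) v z ⟩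
  (conj v *ᵍ v) *ᵍ z  ≡⟨ cong (_*ᵍ z) (conj-unit-inverse v-unit) ⟩
  1ᵍ *ᵍ z             ≡⟨ *ᵍ-identityˡ z ⟩
  z                   ∎
  where open ≡-Reasoning

unit*-≢0 : ∀ {u z} → IsUnit u → z ≢ 0ᵍ → u *ᵍ z ≢ 0ᵍ
unit*-≢0 {u} {z} u-unit z≢0 uz≡0 =
  z≢0 (trans (sym (unit-cancel u-unit z)) (trans (cong (conj u *ᵍ_) uz≡0) (*ᵍ-zeroʳ (conj u))))

IsDigit-unit* : ∀ {u d} → IsUnit u → IsDigit d → IsDigit (u *ᵍ d)
IsDigit-unit* u1 d0 = d0
IsDigit-unit* u-1 d0 = d0
IsDigit-unit* ui d0 = d0
IsDigit-unit* u-i d0 = d0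
IsDigit-unit* u-unit (du v-unit) = du (IsUnit-* u-unit v-unit)

digit-re≤1 : ∀ {d} → IsDigit d → re d ≤ + 1
digit-re≤1 d0 = +≤+ z≤n
digit-re≤1 (du u1) = +≤+ (s≤s z≤n)
digit-re≤1 (du u-1) = -≤+
digit-re≤1 (du ui) = +≤+ z≤n
digit-re≤1 (du u-i) = +≤+ z≤n

digit-re+im≤1 : ∀ {d} → IsDigit d → re d + im d ≤ + 1
digit-re+im≤1 d0 = +≤+ z≤n
digit-re+im≤1 (du u1) = +≤+ (s≤s z≤n)
digit-re+im≤1 (du u-1) = -≤+
digit-re+im≤1 (du ui) = +≤+ (s≤s z≤n)
digit-re+im≤1 (du u-i) = -≤+

Odd𝔾 : 𝔾 → Set
Odd𝔾 z = ¬ (Even (re z) × Even (im z))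

Odd𝔾⇒≢0 : ∀ {z} → Odd𝔾 z → z ≢ 0ᵍ
Odd𝔾⇒≢0 odd refl = odd ((0ℤ , refl) , (0ℤ , refl))

Odd𝔾-unit* : ∀ {v z} → IsUnit v → Odd𝔾 z → Odd𝔾 (v *ᵍ z)
Odd𝔾-unit* {z = z} u1 odd = subst Odd𝔾 (sym (*ᵍ-identityˡ z)) odd
Odd𝔾-unit* {z = x + y i} u-1 odd =
  subst Odd𝔾 (sym (-1*ᵍ x y)) λ (ex , ey) → odd (even-neg⁻¹ ex , even-neg⁻¹ ey)
Odd𝔾-unit* {z = x + y i} ui odd =
  subst Odd𝔾 (sym (i*ᵍ x y)) λ (ey , ex) → odd (ex , even-neg⁻¹ ey)
Odd𝔾-unit* {z = x + y i} u-i odd =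
  subst Odd𝔾 (sym (-i*ᵍ x y)) λ (ey , ex) → odd (even-neg⁻¹ ex , ey)

1+i*-re+im-even : ∀ q → Even (re (1+i *ᵍ q) + im (1+i *ᵍ q))
1+i*-re+im-even (a + b i) = a , sum≡
  where
  sum≡ : (+ 1 * a - + 1 * b) + (+ 1 * b + + 1 * a) ≡ a + a
  sum≡ = solve (a ∷ b ∷ [])

-- (1+i)(a + b i) = (a - b) + (a + b) i, and a - b, a + b have the same parity.
Odd𝔾-1+i*-components : ∀ z → Odd𝔾 (1+i *ᵍ z) → Odd (re (1+i *ᵍ z)) × Odd (im (1+i *ᵍ z))
Odd𝔾-1+i*-components (a + b i) odd with parity (+ 1 * a - + 1 * b) | parity (+ 1 * b + + 1 * a)
... | inj₁ e₁ | inj₁ e₂ = ⊥-elim (odd (e₁ , e₂))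
... | inj₁ e₁ | inj₂ o₂ = ⊥-elim (even⇒¬odd (1+i*-re+im-even (a + b i)) (even+odd e₁ o₂))
... | inj₂ o₁ | inj₁ e₂ = ⊥-elim (even⇒¬odd (1+i*-re+im-even (a + b i)) (odd+even o₁ e₂))
... | inj₂ o₁ | inj₂ o₂ = o₁ , o₂

Odd𝔾-1+i*⁻¹ : ∀ z → Odd𝔾 (1+i *ᵍ z) → Odd𝔾 z
Odd𝔾-1+i*⁻¹ (a + b i) odd (ea , eb) =
  odd (subst Even re≡ (even+even ea (even-neg eb)) , subst Even im≡ (even+even eb ea))
  where re≡ : a + - b ≡ + 1 * a - + 1 * b
        re≡ = solve (a ∷ b ∷ [])
        im≡ : b + a ≡ + 1 * b + + 1 * a
        im≡ = solve (a ∷ b ∷ [])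

-- The octagons

FacetsAt : ℕ → ℤ → ℤ → Set
FacetsAt n x y = (x + + 2 ≤ W n) × (x + y + + 3 ≤ W (suc n))

Facets : ℕ → 𝔾 → Set
Facets n z = FacetsAt n (re z) (im z)

-- The octagon |x|, |y| ≤ w n - 2, |x| + |y| ≤ w (n + 1) - 3 is cut out by
-- the facets of the four rotations of z, which makes it unit invariant.
record Octagon (n : ℕ) (z : 𝔾) : Set where
  constructor octagon
  field facets : ∀ u → IsUnit u → Facets n (u *ᵍ z)
open Octagon

record OctagonIneqs (A B x y : ℤ) : Set where
  field
    x≤ : x + + 2 ≤ A
    -x≤ : - x + + 2 ≤ A
    y≤ : y + + 2 ≤ A
    -y≤ : - y + + 2 ≤ A
    x+y≤ : x + y + + 3 ≤ B
    -x-y≤ : - x + - y + + 3 ≤ B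
    -y+x≤ : - y + x + + 3 ≤ B
    y-x≤ : y - x + + 3 ≤ B

OctagonBounds : ℕ → ℤ → ℤ → Set
OctagonBounds n = OctagonIneqs (W n) (W (suc n))

octagon⇒bounds : ∀ {n x y} → Octagon n (x + y i) → OctagonBounds n x y
octagon⇒bounds {n} {x} {y} oct = record
  { x≤ = proj₁ f₁ ; -x≤ = proj₁ f₋₁ ; y≤ = proj₁ f₋ᵢ ; -y≤ = proj₁ fᵢ
  ; x+y≤ = proj₂ f₁ ; -x-y≤ = proj₂ f₋₁ ; -y+x≤ = proj₂ fᵢ ; y-x≤ = proj₂ f₋ᵢ }
  where
  f₁ = subst (Facets n) (*ᵍ-identityˡ (x + y i)) (facets oct _ u1)
  f₋₁ = subst (Facets n) (-1*ᵍ x y) (facets oct _ u-1)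
  fᵢ = subst (Facets n) (i*ᵍ x y) (facets oct _ ui)
  f₋ᵢ = subst (Facets n) (-i*ᵍ x y) (facets oct _ u-i)

bounds⇒octagon : ∀ {n x y} → OctagonBounds n x y → Octagon n (x + y i)
bounds⇒octagon {n} {x} {y} B = octagon facets-of
  where
  module B = OctagonIneqs B
  facets-of : ∀ u → IsUnit u → Facets n (u *ᵍ (x + y i))
  facets-of _ u1 = subst (Facets n) (sym (*ᵍ-identityˡ (x + y i))) (B.x≤ , B.x+y≤)
  facets-of _ u-1 = subst (Facets n) (sym (-1*ᵍ x y)) (B.-x≤ , B.-x-y≤)
  facets-of _ ui = subst (Facets n) (sym (i*ᵍ x y)) (B.-y≤ , B.-y+x≤)
  facets-of _ u-i = subst (Facets n) (sym (-i*ᵍ x y)) (B.y≤ , B.y-x≤)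

octagon-unit* : ∀ {n z v} → IsUnit v → Octagon n z → Octagon n (v *ᵍ z)
octagon-unit* {n} {z} {v} v-unit oct = octagon λ u u-unit →
  subst (Facets n) (sym (*ᵍ-assoc u v z)) (facets oct (u *ᵍ v) (IsUnit-* u-unit v-unit))

0∈octagon : ∀ n → Octagon n 0ᵍ
0∈octagon n = bounds⇒octagon {n} (record
  { x≤ = 2≤W ; -x≤ = 2≤W ; y≤ = 2≤W ; -y≤ = 2≤W
  ; x+y≤ = 3≤W (suc n) ; -x-y≤ = 3≤W (suc n) ; -y+x≤ = 3≤W (suc n) ; y-x≤ = 3≤W (suc n) })
  where
  2≤W : + 2 ≤ W n
  2≤W = ℤP.≤-trans (+≤+ (s≤s (s≤s z≤n))) (3≤W n)

1∈octagon₀ : Octagon 0 1ᵍ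
1∈octagon₀ = bounds⇒octagon {0} (record
  { x≤ = ℤP.≤ᵇ⇒≤ tt ; -x≤ = ℤP.≤ᵇ⇒≤ tt ; y≤ = ℤP.≤ᵇ⇒≤ tt ; -y≤ = ℤP.≤ᵇ⇒≤ tt
  ; x+y≤ = ℤP.≤ᵇ⇒≤ tt ; -x-y≤ = ℤP.≤ᵇ⇒≤ tt ; -y+x≤ = ℤP.≤ᵇ⇒≤ tt ; y-x≤ = ℤP.≤ᵇ⇒≤ tt })

unit∈octagon₀ : ∀ {u} → IsUnit u → Octagon 0 u
unit∈octagon₀ {u} u-unit = subst (Octagon 0) (*ᵍ-identityʳ u) (octagon-unit* {0} u-unit 1∈octagon₀)

facets-step : ∀ {m d z} → Facets m z → Facets m (iᵍ *ᵍ z) → IsDigit d → Facets (suc m) (d +ᵍ 1+i *ᵍ z)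
facets-step {m} {dx + dy i} {x + y i} (x≤ , _) iz-facets digit =
  re≤ x y dx (W (suc m)) -y+x≤ (digit-re≤1 digit) ,
  ℤP.≤-trans (sum≤ x y dx dy (W m) x≤ (digit-re+im≤1 digit)) (ℤP.≤-reflexive (sym (W-suc-suc m)))
  where
  -y+x≤ = proj₂ (subst (Facets m) (i*ᵍ x y) iz-facets)
  re≤ : ∀ x y dx V → - y + x + + 3 ≤ V → dx ≤ + 1 → dx + (+ 1 * x - + 1 * y) + + 2 ≤ V
  re≤ x y dx V h g = ≤-by _ (gap h ⊕ gap g) (solve (x ∷ y ∷ dx ∷ V ∷ []))
  sum≤ : ∀ x y dx dy V → x + + 2 ≤ V → dx + dy ≤ + 1 →
    dx + (+ 1 * x - + 1 * y) + (dy + (+ 1 * y + + 1 * x)) + + 3 ≤ V + V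
  sum≤ x y dx dy V h g = ≤-by _ (gap h ⊕ gap h ⊕ gap g) (solve (x ∷ y ∷ dx ∷ dy ∷ V ∷ []))

octagon-step : ∀ {m d z} → Octagon m z → IsDigit d → Octagon (suc m) (d +ᵍ 1+i *ᵍ z)
octagon-step {m} {d} {z} oct digit = octagon λ v v-unit →
  subst (Facets (suc m)) (sym (*ᵍ-distrib-digit v d z))
    (facets-step {m} {v *ᵍ d} {v *ᵍ z} (facets oct v v-unit)
                 (subst (Facets m) (sym (*ᵍ-assoc iᵍ v z)) (facets oct _ (IsUnit-* ui v-unit)))
                 (IsDigit-unit* v-unit digit))

facets-halve : ∀ {n} z → Facets (suc n) (1+i *ᵍ z) → Facets (suc n) (-iᵍ *ᵍ (1+i *ᵍ z)) →
  Odd (im (1+i *ᵍ z)) → Facets n z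
facets-halve {n} (a + b i) (_ , re+im≤) rotated-facets a+b-odd =
  halve-+3≤ a (W n) (subst (a + a + + 3 ≤_) (W-suc-suc n) (2a+3≤ a b _ re+im≤)) ,
  subst (_≤ W (suc n)) a+b≡ (odd+2≤even⇒+3≤ (+ 1 * b + + 1 * a) _ a+b-odd (W-suc-even n) a+b+2≤)
  where
  a+b+2≤ = proj₁ (subst (Facets (suc n)) (-i*ᵍ (+ 1 * a - + 1 * b) (+ 1 * b + + 1 * a)) rotated-facets)
  a+b≡ : + 1 * b + + 1 * a + + 3 ≡ a + b + + 3
  a+b≡ = solve (a ∷ b ∷ [])
  2a+3≤ : ∀ a b V → (+ 1 * a - + 1 * b) + (+ 1 * b + + 1 * a) + + 3 ≤ V → a + a + + 3 ≤ V
  2a+3≤ a b V h = ≤-by _ (gap h) (solve (a ∷ b ∷ V ∷ []))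

octagon-halve : ∀ {n z} → Octagon (suc n) (1+i *ᵍ z) → Odd𝔾 (1+i *ᵍ z) → Octagon n z × Odd𝔾 z
octagon-halve {n} {z} oct odd = octagon halved , Odd𝔾-1+i*⁻¹ z odd
  where
  rotate : ∀ u v → (u *ᵍ v) *ᵍ (1+i *ᵍ z) ≡ u *ᵍ (1+i *ᵍ (v *ᵍ z))
  rotate u v = trans (sym (*ᵍ-assoc u v (1+i *ᵍ z))) (cong (u *ᵍ_) (*ᵍ-comm-1+i v z))
  halved : ∀ v → IsUnit v → Facets n (v *ᵍ z)
  halved v v-unit = facets-halve {n} (v *ᵍ z)
    (subst (Facets (suc n)) (*ᵍ-comm-1+i v z) (facets oct v v-unit))
    (subst (Facets (suc n)) (rotate -iᵍ v) (facets oct _ (IsUnit-* u-i v-unit)))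
    (proj₂ (Odd𝔾-1+i*-components (v *ᵍ z) (subst Odd𝔾 (*ᵍ-comm-1+i v z) (Odd𝔾-unit* v-unit odd))))

octagon-ineqs-double : ∀ {A B x y} → OctagonIneqs A B x y → OctagonIneqs (A + A) (B + B) (x + x) (y + y)
octagon-ineqs-double {A} {B} {x} {y} O = record
  { x≤ = ≤-by _ (gap O.x≤ ⊕ gap O.x≤ ⊕ 0≤+ 2) (solve (x ∷ A ∷ []))
  ; -x≤ = ≤-by _ (gap O.-x≤ ⊕ gap O.-x≤ ⊕ 0≤+ 2) (solve (x ∷ A ∷ []))
  ; y≤ = ≤-by _ (gap O.y≤ ⊕ gap O.y≤ ⊕ 0≤+ 2) (solve (y ∷ A ∷ []))
  ; -y≤ = ≤-by _ (gap O.-y≤ ⊕ gap O.-y≤ ⊕ 0≤+ 2) (solve (y ∷ A ∷ []))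
  ; x+y≤ = ≤-by _ (gap O.x+y≤ ⊕ gap O.x+y≤ ⊕ 0≤+ 3) (solve (x ∷ y ∷ B ∷ []))
  ; -x-y≤ = ≤-by _ (gap O.-x-y≤ ⊕ gap O.-x-y≤ ⊕ 0≤+ 3) (solve (x ∷ y ∷ B ∷ []))
  ; -y+x≤ = ≤-by _ (gap O.-y+x≤ ⊕ gap O.-y+x≤ ⊕ 0≤+ 3) (solve (x ∷ y ∷ B ∷ []))
  ; y-x≤ = ≤-by _ (gap O.y-x≤ ⊕ gap O.y-x≤ ⊕ 0≤+ 3) (solve (x ∷ y ∷ B ∷ [])) }
  where module O = OctagonIneqs O

octagon-bounds-double : ∀ {n x y} → OctagonBounds n x y → OctagonBounds (suc (suc n)) (x + x) (y + y)
octagon-bounds-double {n} {x} {y} O =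
  subst₂ (λ A B → OctagonIneqs A B (x + x) (y + y)) (sym (W-suc-suc n)) (sym (W-suc-suc (suc n)))
    (octagon-ineqs-double O)

∣x∣≤1 : ∀ x → x + + 2 ≤ + 3 → - x + + 2 ≤ + 3 → x ≡ 0ℤ ⊎ x ≡ + 1 ⊎ x ≡ - + 1
∣x∣≤1 (+ 0) _ _ = inj₁ refl
∣x∣≤1 (+ 1) _ _ = inj₂ (inj₁ refl)
∣x∣≤1 (+ suc (suc k)) (+≤+ (s≤s (s≤s k+2≤1))) _ = ⊥-elim (ℕP.<-irrefl refl (ℕP.m+n≤o⇒n≤o k k+2≤1))
∣x∣≤1 -[1+ 0 ] _ _ = inj₂ (inj₂ refl)
∣x∣≤1 -[1+ suc k ] _ (+≤+ (s≤s (s≤s k+2≤1))) = ⊥-elim (ℕP.<-irrefl refl (ℕP.m+n≤o⇒n≤o k k+2≤1))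

odd∈octagon₀⇒unit : ∀ {z} → Odd𝔾 z → Octagon 0 z → IsUnit z
odd∈octagon₀⇒unit {x + y i} odd oct with octagon⇒bounds {0} oct
... | O with ∣x∣≤1 x (OctagonIneqs.x≤ O) (OctagonIneqs.-x≤ O)
           | ∣x∣≤1 y (OctagonIneqs.y≤ O) (OctagonIneqs.-y≤ O)
... | inj₁ refl | inj₁ refl = ⊥-elim (odd ((0ℤ , refl) , (0ℤ , refl)))
... | inj₁ refl | inj₂ (inj₁ refl) = ui
... | inj₁ refl | inj₂ (inj₂ refl) = u-i
... | inj₂ (inj₁ refl) | inj₁ refl = u1
... | inj₂ (inj₂ refl) | inj₁ refl = u-1
... | inj₂ (inj₁ refl) | inj₂ (inj₁ refl) = ⊥-elim (ℤP.≤⇒≤ᵇ (OctagonIneqs.x+y≤ O))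
... | inj₂ (inj₁ refl) | inj₂ (inj₂ refl) = ⊥-elim (ℤP.≤⇒≤ᵇ (OctagonIneqs.-y+x≤ O))
... | inj₂ (inj₂ refl) | inj₂ (inj₁ refl) = ⊥-elim (ℤP.≤⇒≤ᵇ (OctagonIneqs.y-x≤ O))
... | inj₂ (inj₂ refl) | inj₂ (inj₂ refl) = ⊥-elim (ℤP.≤⇒≤ᵇ (OctagonIneqs.-x-y≤ O))

UnitDigitSplit : ℕ → 𝔾 → Set
UnitDigitSplit m z = Σ 𝔾 λ u → Σ 𝔾 λ q → IsUnit u × z ≡ u +ᵍ 1+i *ᵍ q × Octagon m q × Odd𝔾 q

split-unit*⁻¹ : ∀ {m z v} → IsUnit v → UnitDigitSplit m (v *ᵍ z) → UnitDigitSplit m z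
split-unit*⁻¹ {m} {z} {v} v-unit (u , q , u-unit , vz≡ , q-oct , q-odd) =
  conj v *ᵍ u , conj v *ᵍ q , IsUnit-* (IsUnit-conj v-unit) u-unit ,
  trans (sym (unit-cancel v-unit z)) (trans (cong (conj v *ᵍ_) vz≡) (*ᵍ-distrib-digit (conj v) u q)) ,
  octagon-unit* {m} (IsUnit-conj v-unit) q-oct , Odd𝔾-unit* (IsUnit-conj v-unit) q-odd

split-ineqs : ∀ x y t V₀ V₁ → x + y ≡ t + t + + 1 → 0ℤ ≤ x → V₁ + + 1 ≤ V₀ + V₀ → + 4 ≤ V₁ →
  x + + 2 ≤ V₁ → y + + 3 ≤ V₁ → - y + + 3 ≤ V₁ → x + y + + 3 ≤ V₀ + V₀ → - y + x + + 3 ≤ V₀ + V₀ →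
  OctagonIneqs V₀ V₁ t (y - t)
split-ineqs x y t V₀ V₁ x+y≡ 0≤x V₁<2V₀ 4≤V₁ x≤ y≤ -y≤ x+y≤ -y+x≤ = record
  { x≤ = halve-+3≤ t V₀ (≤-by _ (gap x+y≤ ⊕ x+y≥ ⊕ 0≤+ 1) (solve (x ∷ y ∷ t ∷ V₀ ∷ [])))
  ; -x≤ = halve-+3≤ (- t) V₀ (≤-by _ (gap V₁<2V₀ ⊕ gap -y≤ ⊕ 0≤x ⊕ x+y≤′) (solve (x ∷ y ∷ t ∷ V₀ ∷ V₁ ∷ [])))
  ; y≤ = halve-+3≤ (y - t) V₀ (≤-by _ (gap y≤ ⊕ gap V₁<2V₀ ⊕ 0≤x ⊕ x+y≤′) (solve (x ∷ y ∷ t ∷ V₀ ∷ V₁ ∷ [])))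
  ; -y≤ = halve-+3≤ (- (y - t)) V₀ (≤-by _ (gap -y+x≤ ⊕ x+y≥ ⊕ 0≤+ 1) (solve (x ∷ y ∷ t ∷ V₀ ∷ [])))
  ; x+y≤ = ≤-by _ (gap y≤) (solve (y ∷ t ∷ V₁ ∷ []))
  ; -x-y≤ = ≤-by _ (gap -y≤) (solve (y ∷ t ∷ V₁ ∷ []))
  ; -y+x≤ = ≤-by _ (gap x≤ ⊕ x+y≥) (solve (x ∷ y ∷ t ∷ V₁ ∷ []))
  ; y-x≤ = ≤-by _ (gap 4≤V₁ ⊕ 0≤x ⊕ x+y≤′) (solve (x ∷ y ∷ t ∷ V₁ ∷ [])) }
  where
  x+y≥ : 0ℤ ≤ (x + y) - (t + t + + 1)
  x+y≥ = gap (ℤP.≤-reflexive (sym x+y≡))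
  x+y≤′ : 0ℤ ≤ (t + t + + 1) - (x + y)
  x+y≤′ = gap (ℤP.≤-reflexive x+y≡)

-- With x + y = 2t + 1, the point x + y i is 1 + (1+i)(t + (y - t) i).
split-at-1 : ∀ {m} x y → Even x → Odd y → 0ℤ ≤ x → OctagonBounds (suc m) x y → UnitDigitSplit m (x + y i)
split-at-1 {m} x y x-even y-odd 0≤x O with even+odd x-even y-odd
... | t , x+y≡ = 1ᵍ , t + (y - t) i , u1 , cong₂ _+_i re≡ im≡ ,
  bounds⇒octagon {m} (split-ineqs x y t (W m) (W (suc m)) x+y≡ 0≤x
    (subst (W (suc m) + + 1 ≤_) (W-suc-suc m) (W+1≤W-suc (suc m))) (4≤W-suc m) O.x≤
    (odd+2≤even⇒+3≤ y _ y-odd (W-suc-even m) O.y≤)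
    (odd+2≤even⇒+3≤ (- y) _ (odd-neg y-odd) (W-suc-even m) O.-y≤)
    (subst (x + y + + 3 ≤_) (W-suc-suc m) O.x+y≤) (subst (- y + x + + 3 ≤_) (W-suc-suc m) O.-y+x≤)) ,
  λ (t-even , y-t-even) → even⇒¬odd (subst Even t+[y-t]≡y (even+even t-even y-t-even)) y-odd
  where
  module O = OctagonIneqs O
  re≡ : x ≡ + 1 + (+ 1 * t - + 1 * (y - t))
  re≡ = begin
    x                              ≡⟨ solve (x ∷ y ∷ []) ⟩
    (x + y) - y                    ≡⟨ cong (_- y) x+y≡ ⟩
    (t + t + + 1) - y              ≡⟨ solve (y ∷ t ∷ []) ⟩
    + 1 + (+ 1 * t - + 1 * (y - t)) ∎
    where open ≡-Reasoning
  im≡ : y ≡ + 0 + (+ 1 * (y - t) + + 1 * t)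
  im≡ = solve (y ∷ t ∷ [])
  t+[y-t]≡y : t + (y - t) ≡ y
  t+[y-t]≡y = solve (y ∷ t ∷ [])

split-even-odd : ∀ {m} x y → Even x → Odd y → Octagon (suc m) (x + y i) → UnitDigitSplit m (x + y i)
split-even-odd {m} x y x-even y-odd oct with 0ℤ ℤ.≤? x
... | yes 0≤x = split-at-1 {m} x y x-even y-odd 0≤x (octagon⇒bounds {suc m} oct)
... | no 0≰x = split-unit*⁻¹ u-1 (subst (UnitDigitSplit m) (sym (-1*ᵍ x y))
  (split-at-1 {m} (- x) (- y) (even-neg x-even) (odd-neg y-odd) (ℤP.neg-mono-≤ (ℤP.<⇒≤ (ℤP.≰⇒> 0≰x)))
    (octagon⇒bounds {suc m} (subst (Octagon (suc m)) (-1*ᵍ x y) (octagon-unit* {suc m} u-1 oct)))))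

split-mixed-parity : ∀ {m} x y → (Even x × Odd y) ⊎ (Odd x × Even y) → Octagon (suc m) (x + y i) →
  UnitDigitSplit m (x + y i)
split-mixed-parity {m} x y (inj₁ (x-even , y-odd)) oct = split-even-odd {m} x y x-even y-odd oct
split-mixed-parity {m} x y (inj₂ (x-odd , y-even)) oct =
  split-unit*⁻¹ u-i (subst (UnitDigitSplit m) (sym (-i*ᵍ x y)) (split-even-odd {m} y (- x) y-even (odd-neg x-odd)
    (subst (Octagon (suc m)) (-i*ᵍ x y) (octagon-unit* {suc m} u-i oct))))

1+i∣ : ∀ x y → Even (x + y) → Σ 𝔾 λ q → x + y i ≡ 1+i *ᵍ q
1+i∣ x y (t , x+y≡) = t + (t - x) i , cong₂ _+_i re≡ im≡
  where
  re≡ : x ≡ + 1 * t - + 1 * (t - x)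
  re≡ = solve (x ∷ t ∷ [])
  im≡ : y ≡ + 1 * (t - x) + + 1 * t
  im≡ = begin
    y                          ≡⟨ solve (x ∷ y ∷ []) ⟩
    (x + y) - x                ≡⟨ cong (_- x) x+y≡ ⟩
    (t + t) - x                ≡⟨ solve (x ∷ t ∷ []) ⟩
    + 1 * (t - x) + + 1 * t    ∎
    where open ≡-Reasoning

1+i*-injective : ∀ {q q′} → 1+i *ᵍ q ≡ 1+i *ᵍ q′ → q ≡ q′
1+i*-injective {a + b i} {a′ + b′ i} eq = cong₂ _+_i a≡a′ b≡b′
  where
  a≡a′ : a ≡ a′
  a≡a′ = double-injective a a′ (begin
    a + a                                              ≡⟨ solve (a ∷ b ∷ []) ⟩
    (+ 1 * a - + 1 * b) + (+ 1 * b + + 1 * a)          ≡⟨ cong₂ _+_ (cong re eq) (cong im eq) ⟩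
    (+ 1 * a′ - + 1 * b′) + (+ 1 * b′ + + 1 * a′)      ≡⟨ solve (a′ ∷ b′ ∷ []) ⟩
    a′ + a′                                            ∎)
    where open ≡-Reasoning
  b≡b′ : b ≡ b′
  b≡b′ = begin
    b                        ≡⟨ solve (a ∷ b ∷ []) ⟩
    (+ 1 * b + + 1 * a) - a  ≡⟨ cong₂ _-_ (cong im eq) a≡a′ ⟩
    (+ 1 * b′ + + 1 * a′) - a′ ≡⟨ solve (a′ ∷ b′ ∷ []) ⟩
    b′                       ∎
    where open ≡-Reasoning

-- Expansions and the regions φ ≤ n

-- Expansion n z: z = Σ_{j ≤ n} u_j (1+i)^j with digits u_j, leading zeros allowed.
data Expansion : ℕ → 𝔾 → Set where
  [_] : ∀ {d} → IsDigit d → Expansion 0 d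
  _∷_ : ∀ {n d z} → IsDigit d → Expansion n z → Expansion (suc n) (d +ᵍ 1+i *ᵍ z)

infixr 5 _∷_

0-expansion : ∀ n → Expansion n 0ᵍ
0-expansion zero = [ d0 ]
0-expansion (suc n) = d0 ∷ 0-expansion n

expansion-unit* : ∀ {n z v} → IsUnit v → Expansion n z → Expansion n (v *ᵍ z)
expansion-unit* v-unit [ digit ] = [ IsDigit-unit* v-unit digit ]
expansion-unit* {v = v} v-unit (_∷_ {d = d} {z} digit e) =
  subst (Expansion _) (sym (*ᵍ-distrib-digit v d z)) (IsDigit-unit* v-unit digit ∷ expansion-unit* v-unit e)

double : 𝔾 → 𝔾
double z = (re z + re z) + (im z + im z) i

double≡0⇒≡0 : ∀ {z} → double z ≡ 0ᵍ → z ≡ 0ᵍ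
double≡0⇒≡0 {x + y i} 2z≡0 =
  cong₂ _+_i (double-injective x 0ℤ (cong re 2z≡0)) (double-injective y 0ℤ (cong im 2z≡0))

-- The elements with an expansion of at most n + 1 digits, described by octagons.
data Region : ℕ → 𝔾 → Set where
  zero∈ : ∀ {n} → Region n 0ᵍ
  odd∈ : ∀ {n z} → Odd𝔾 z → Octagon n z → Region n z
  double∈ : ∀ {n z} → Region n z → Region (suc (suc n)) (double z)

region⇒octagon : ∀ {n z} → Region n z → Octagon n z
region⇒octagon {n} zero∈ = 0∈octagon n
region⇒octagon (odd∈ _ oct) = oct
region⇒octagon {suc (suc n)} (double∈ {z = z} r) =
  bounds⇒octagon {suc (suc n)} (octagon-bounds-double {n} (octagon⇒bounds {n} (region⇒octagon r)))

unit-re+im-odd : ∀ {u} → IsUnit u → Odd (re u + im u)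
unit-re+im-odd u1 = 0ℤ , refl
unit-re+im-odd u-1 = - + 1 , refl
unit-re+im-odd ui = 0ℤ , refl
unit-re+im-odd u-i = - + 1 , refl

unit-digit-Odd𝔾 : ∀ {u} → IsUnit u → ∀ z → Odd𝔾 (u +ᵍ 1+i *ᵍ z)
unit-digit-Odd𝔾 {u₁ + u₂ i} u-unit (a + b i) (e₁ , e₂) =
  even⇒¬odd (even+even e₁ e₂) (subst Odd sum≡ (odd+even (unit-re+im-odd u-unit) (a , refl)))
  where
  sum≡ : (u₁ + u₂) + (a + a) ≡ (u₁ + (+ 1 * a - + 1 * b)) + (u₂ + (+ 1 * b + + 1 * a))
  sum≡ = solve (u₁ ∷ u₂ ∷ a ∷ b ∷ [])

unit-not-both-odd : ∀ {u} → IsUnit u → Odd (re u) → ¬ Odd (im u)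
unit-not-both-odd u1 _ = even⇒¬odd (0ℤ , refl)
unit-not-both-odd u-1 _ = even⇒¬odd (0ℤ , refl)
unit-not-both-odd ui re-odd = ⊥-elim (even⇒¬odd (0ℤ , refl) re-odd)
unit-not-both-odd u-i re-odd = ⊥-elim (even⇒¬odd (0ℤ , refl) re-odd)

1+i*1+i* : ∀ q → 0ᵍ +ᵍ 1+i *ᵍ (1+i *ᵍ q) ≡ double (iᵍ *ᵍ q)
1+i*1+i* (a + b i) = cong₂ _+_i re≡ im≡
  where
  re≡ : + 0 + (+ 1 * (+ 1 * a - + 1 * b) - + 1 * (+ 1 * b + + 1 * a)) ≡ (+ 0 * a - + 1 * b) + (+ 0 * a - + 1 * b)
  re≡ = solve (a ∷ b ∷ [])
  im≡ : + 0 + (+ 1 * (+ 1 * b + + 1 * a) + + 1 * (+ 1 * a - + 1 * b)) ≡ (+ 0 * b + + 1 * a) + (+ 0 * b + + 1 * a)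
  im≡ = solve (a ∷ b ∷ [])

1+i*-double : ∀ z → 0ᵍ +ᵍ 1+i *ᵍ double z ≡ double (0ᵍ +ᵍ 1+i *ᵍ z)
1+i*-double (a + b i) = cong₂ _+_i re≡ im≡
  where
  re≡ : + 0 + (+ 1 * (a + a) - + 1 * (b + b)) ≡ (+ 0 + (+ 1 * a - + 1 * b)) + (+ 0 + (+ 1 * a - + 1 * b))
  re≡ = solve (a ∷ b ∷ [])
  im≡ : + 0 + (+ 1 * (b + b) + + 1 * (a + a)) ≡ (+ 0 + (+ 1 * b + + 1 * a)) + (+ 0 + (+ 1 * b + + 1 * a))
  im≡ = solve (a ∷ b ∷ [])

double≡ : ∀ z → double z ≡ 0ᵍ +ᵍ 1+i *ᵍ (0ᵍ +ᵍ 1+i *ᵍ (-iᵍ *ᵍ z))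
double≡ z = begin
  double z                                           ≡⟨ cong double (sym i*-i*z) ⟩
  double (iᵍ *ᵍ (-iᵍ *ᵍ z))                          ≡⟨ sym (1+i*1+i* (-iᵍ *ᵍ z)) ⟩
  0ᵍ +ᵍ 1+i *ᵍ (1+i *ᵍ (-iᵍ *ᵍ z))                   ≡⟨ cong (λ q → 0ᵍ +ᵍ 1+i *ᵍ q)
                                                         (sym (+ᵍ-identityˡ (1+i *ᵍ (-iᵍ *ᵍ z)))) ⟩
  0ᵍ +ᵍ 1+i *ᵍ (0ᵍ +ᵍ 1+i *ᵍ (-iᵍ *ᵍ z))             ∎
  where
  open ≡-Reasoning
  i*-i*z : iᵍ *ᵍ (-iᵍ *ᵍ z) ≡ z
  i*-i*z = trans (*ᵍ-assoc iᵍ -iᵍ z) (*ᵍ-identityˡ z)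

unit-Odd𝔾 : ∀ {u} → IsUnit u → Odd𝔾 u
unit-Odd𝔾 u-unit (e₁ , e₂) = even⇒¬odd (even+even e₁ e₂) (unit-re+im-odd u-unit)

-- If a and b are odd then a + b i = (1+i) q, and appending the digit 0 gives 2 i q.
region-shift-both-odd : ∀ m a b → Odd a → Odd b → Odd𝔾 (a + b i) → Octagon m (a + b i) →
  Region (suc m) (0ᵍ +ᵍ 1+i *ᵍ (a + b i))
region-shift-both-odd zero a b a-odd b-odd odd oct =
  ⊥-elim (unit-not-both-odd (odd∈octagon₀⇒unit odd oct) a-odd b-odd)
region-shift-both-odd (suc m) a b a-odd b-odd odd oct with 1+i∣ a b (odd+odd a-odd b-odd)
... | q , a+bi≡ = subst (Region (suc (suc m))) (sym (trans (cong (λ t → 0ᵍ +ᵍ 1+i *ᵍ t) a+bi≡) (1+i*1+i* q)))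
  (double∈ (odd∈ (Odd𝔾-unit* ui (proj₂ halved)) (octagon-unit* {m} ui (proj₁ halved))))
  where halved = octagon-halve {m} {q} (subst (Octagon (suc m)) a+bi≡ oct) (subst Odd𝔾 a+bi≡ odd)

region-shift-odd : ∀ m a b → Odd𝔾 (a + b i) → Octagon m (a + b i) → Region (suc m) (0ᵍ +ᵍ 1+i *ᵍ (a + b i))
region-shift-odd m a b odd oct = shift (parity a) (parity b)
  where
  mixed : Odd (a + b) → Region (suc m) (0ᵍ +ᵍ 1+i *ᵍ (a + b i))
  mixed a+b-odd = odd∈ (λ (_ , im-even) → even⇒¬odd im-even (subst Odd im≡ a+b-odd)) (octagon-step oct d0)
    where
    im≡ : a + b ≡ + 0 + (+ 1 * b + + 1 * a)
    im≡ = solve (a ∷ b ∷ [])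
  shift : Even a ⊎ Odd a → Even b ⊎ Odd b → Region (suc m) (0ᵍ +ᵍ 1+i *ᵍ (a + b i))
  shift (inj₁ a-even) (inj₁ b-even) = ⊥-elim (odd (a-even , b-even))
  shift (inj₁ a-even) (inj₂ b-odd) = mixed (even+odd a-even b-odd)
  shift (inj₂ a-odd) (inj₁ b-even) = mixed (odd+even a-odd b-even)
  shift (inj₂ a-odd) (inj₂ b-odd) = region-shift-both-odd m a b a-odd b-odd odd oct

region-step : ∀ {m d z} → Region m z → IsDigit d → Region (suc m) (d +ᵍ 1+i *ᵍ z)
region-step {z = z} r (du u-unit) = odd∈ (unit-digit-Odd𝔾 u-unit z) (octagon-step (region⇒octagon r) (du u-unit))
region-step zero∈ d0 = zero∈
region-step {m} (odd∈ {z = a + b i} odd oct) d0 = region-shift-odd m a b odd oct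
region-step (double∈ {z = z} r) d0 = subst (Region _) (sym (1+i*-double z)) (double∈ (region-step r d0))

expansion⇒region : ∀ {n z} → Expansion n z → Region n z
expansion⇒region [ d0 ] = zero∈
expansion⇒region [ du u-unit ] = odd∈ (unit-Odd𝔾 u-unit) (unit∈octagon₀ u-unit)
expansion⇒region (digit ∷ e) = region-step (expansion⇒region e) digit

-- The last digit is 0 if both coordinates are odd and a unit otherwise; either way
-- the rest is odd and lies in the octagon one level down.
odd∈octagon⇒expansion : ∀ n z → Odd𝔾 z → Octagon n z → Expansion n z
odd∈octagon⇒expansion zero z odd oct = [ du (odd∈octagon₀⇒unit odd oct) ]
odd∈octagon⇒expansion (suc m) (x + y i) odd oct = expand (parity x) (parity y)
  where
  after-digit : ∀ {d q} → IsDigit d → x + y i ≡ d +ᵍ 1+i *ᵍ q → Octagon m q → Odd𝔾 q →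
    Expansion (suc m) (x + y i)
  after-digit {q = q} digit z≡ q-oct q-odd =
    subst (Expansion (suc m)) (sym z≡) (digit ∷ odd∈octagon⇒expansion m q q-odd q-oct)
  after-split : UnitDigitSplit m (x + y i) → Expansion (suc m) (x + y i)
  after-split (u , q , u-unit , z≡ , q-oct , q-odd) = after-digit (du u-unit) z≡ q-oct q-odd
  after-halving : Σ 𝔾 (λ q → x + y i ≡ 1+i *ᵍ q) → Expansion (suc m) (x + y i)
  after-halving (q , z≡) =
    after-digit d0 (trans z≡ (sym (+ᵍ-identityˡ (1+i *ᵍ q)))) (proj₁ halved) (proj₂ halved)
    where halved = octagon-halve {m} {q} (subst (Octagon (suc m)) z≡ oct) (subst Odd𝔾 z≡ odd)
  expand : Even x ⊎ Odd x → Even y ⊎ Odd y → Expansion (suc m) (x + y i)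
  expand (inj₁ x-even) (inj₁ y-even) = ⊥-elim (odd (x-even , y-even))
  expand (inj₁ x-even) (inj₂ y-odd) = after-split (split-mixed-parity x y (inj₁ (x-even , y-odd)) oct)
  expand (inj₂ x-odd) (inj₁ y-even) = after-split (split-mixed-parity x y (inj₂ (x-odd , y-even)) oct)
  expand (inj₂ x-odd) (inj₂ y-odd) = after-halving (1+i∣ x y (odd+odd x-odd y-odd))

region⇒expansion : ∀ {n z} → Region n z → Expansion n z
region⇒expansion {n} zero∈ = 0-expansion n
region⇒expansion {n} (odd∈ odd oct) = odd∈octagon⇒expansion n _ odd oct
region⇒expansion (double∈ {z = z} r) =
  subst (Expansion _) (sym (double≡ z)) (d0 ∷ d0 ∷ expansion-unit* u-i (region⇒expansion r))

_≟ᵍ_ : (a b : 𝔾) → Dec (a ≡ b)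
(a₁ + a₂ i) ≟ᵍ (b₁ + b₂ i) =
  Dec.map′ (λ (eq₁ , eq₂) → cong₂ _+_i eq₁ eq₂) (λ eq → cong re eq , cong im eq)
    ((a₁ ℤP.≟ b₁) Dec.×-dec (a₂ ℤP.≟ b₂))

any-digit? : ∀ {P : 𝔾 → Set} → (∀ d → Dec (P d)) → Dec (Σ 𝔾 λ d → IsDigit d × P d)
any-digit? P? with P? 0ᵍ | P? 1ᵍ | P? -1ᵍ | P? iᵍ | P? -iᵍ
... | yes p | _ | _ | _ | _ = yes (0ᵍ , d0 , p)
... | no _ | yes p | _ | _ | _ = yes (1ᵍ , du u1 , p)
... | no _ | no _ | yes p | _ | _ = yes (-1ᵍ , du u-1 , p)
... | no _ | no _ | no _ | yes p | _ = yes (iᵍ , du ui , p)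
... | no _ | no _ | no _ | no _ | yes p = yes (-iᵍ , du u-i , p)
... | no ¬p₀ | no ¬p₁ | no ¬p₂ | no ¬p₃ | no ¬p₄ = no λ
  { (_ , d0 , p) → ¬p₀ p
  ; (_ , du u1 , p) → ¬p₁ p
  ; (_ , du u-1 , p) → ¬p₂ p
  ; (_ , du ui , p) → ¬p₃ p
  ; (_ , du u-i , p) → ¬p₄ p
  }

digit? : ∀ z → Dec (IsDigit z)
digit? z = Dec.map′ (λ (_ , digit , z≡d) → subst IsDigit (sym z≡d) digit) (λ digit → z , digit , refl)
  (any-digit? (z ≟ᵍ_))

+ᵍ--ᵍ-cancel : ∀ d w → (d +ᵍ w) -ᵍ d ≡ w
+ᵍ--ᵍ-cancel (d₁ + d₂ i) (w₁ + w₂ i) = cong₂ _+_i (cancel d₁ w₁) (cancel d₂ w₂)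
  where
  cancel : ∀ a b → (a + b) - a ≡ b
  cancel a b = solve (a ∷ b ∷ [])

-ᵍ-+ᵍ-cancel : ∀ d z → d +ᵍ (z -ᵍ d) ≡ z
-ᵍ-+ᵍ-cancel (d₁ + d₂ i) (z₁ + z₂ i) = cong₂ _+_i (cancel d₁ z₁) (cancel d₂ z₂)
  where
  cancel : ∀ a b → a + (b - a) ≡ b
  cancel a b = solve (a ∷ b ∷ [])

Tail : ℕ → 𝔾 → 𝔾 → Set
Tail m z d = Σ 𝔾 λ q → z ≡ d +ᵍ 1+i *ᵍ q × Expansion m q

-- 1 + i divides z - d iff its coordinate sum is even, and then the quotient is unique.
tail? : ∀ m z d → (∀ q → Dec (Expansion m q)) → Dec (Tail m z d)
tail? m z d expansion-m? with parity (re (z -ᵍ d) + im (z -ᵍ d))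
... | inj₂ odd = no λ (q , z≡ , _) → even⇒¬odd (subst (λ t → Even (re t + im t))
  (sym (trans (cong (_-ᵍ d) z≡) (+ᵍ--ᵍ-cancel d (1+i *ᵍ q)))) (1+i*-re+im-even q)) odd
... | inj₁ even with 1+i∣ (re (z -ᵍ d)) (im (z -ᵍ d)) even
...   | q , z-d≡ with expansion-m? q
...     | yes e = yes (q , trans (sym (-ᵍ-+ᵍ-cancel d z)) (cong (d +ᵍ_) z-d≡) , e)
...     | no ¬e = no λ (q′ , z≡ , e′) → ¬e (subst (Expansion m) (1+i*-injective
          (trans (sym (+ᵍ--ᵍ-cancel d (1+i *ᵍ q′))) (trans (cong (_-ᵍ d) (sym z≡)) z-d≡))) e′)

expansion-tail : ∀ {m z} → Expansion (suc m) z → Σ 𝔾 λ d → IsDigit d × Tail m z d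
expansion-tail (digit ∷ e) = _ , digit , _ , refl , e

expansion? : ∀ n z → Dec (Expansion n z)
expansion? zero z = Dec.map′ [_] (λ { [ digit ] → digit }) (digit? z)
expansion? (suc m) z = Dec.map′
  (λ (_ , digit , _ , z≡ , e) → subst (Expansion (suc m)) (sym z≡) (digit ∷ e)) expansion-tail
  (any-digit? (λ d → tail? m z d (expansion? m)))

hasExp⇒expansion : ∀ {z m} → HasExp z m → Expansion m z
hasExp⇒expansion (us , digits , _ , refl) = digits⇒expansion us digits
  where
  digits⇒expansion : ∀ {m} (us : V.Vec 𝔾 (suc m)) → All.All IsDigit us → Expansion m (evalExp us)
  digits⇒expansion {zero} (u V.∷ V.[]) (digit All.∷ All.[]) =
    subst (Expansion 0) (sym (+ᵍ-identityʳ-1+i*0 u)) [ digit ]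
  digits⇒expansion {suc m} (u V.∷ us) (digit All.∷ digits) = digit ∷ digits⇒expansion us digits

expansion⇒hasExp : ∀ {n z} → Expansion n z → z ≢ 0ᵍ → Σ ℕ λ m → m ℕ.≤ n × HasExp z m
expansion⇒hasExp {z = z} [ digit ] z≢0 =
  0 , z≤n , (z V.∷ V.[]) , (digit All.∷ All.[]) , z≢0 , +ᵍ-identityʳ-1+i*0 z
expansion⇒hasExp (_∷_ {d = d} {z = q} digit e) z≢0 with q ≟ᵍ 0ᵍ
... | yes refl = 0 , z≤n , (d V.∷ V.[]) , (digit All.∷ All.[]) ,
  (λ d≡0 → z≢0 (trans (+ᵍ-identityʳ-1+i*0 d) d≡0)) , refl
... | no q≢0 with expansion⇒hasExp e q≢0
...   | m , m≤n , us , digits , top≢0 , us≡q =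
  suc m , s≤s m≤n , (d V.∷ us) , (digit All.∷ digits) , top≢0 , cong (λ t → d +ᵍ 1+i *ᵍ t) us≡q

bounded-search : ∀ {P : ℕ → Set} → (∀ k → Dec (P k)) → ∀ n →
  (∀ k → k ℕ.< n → ¬ P k) ⊎ (Σ ℕ λ p → p ℕ.< n × P p × (∀ k → k ℕ.< p → ¬ P k))
bounded-search P? zero = inj₁ λ _ ()
bounded-search P? (suc n) with bounded-search P? n
... | inj₂ (p , p<n , Pp , below) = inj₂ (p , ℕP.m<n⇒m<1+n p<n , Pp , below)
... | inj₁ none with P? n
...   | yes Pn = inj₂ (n , ℕP.n<1+n n , Pn , none)
...   | no ¬Pn = inj₁ λ k k<1+n → [ none k , (λ { refl → ¬Pn }) ]′ (ℕP.m<1+n⇒m<n∨m≡n k<1+n)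

least : ∀ {P : ℕ → Set} → (∀ k → Dec (P k)) → ∀ {n} → P n →
  Σ ℕ λ p → p ℕ.≤ n × P p × (∀ k → k ℕ.< p → ¬ P k)
least P? {n} Pn with bounded-search P? (suc n)
... | inj₁ none = ⊥-elim (none n (ℕP.n<1+n n) Pn)
... | inj₂ (p , p<1+n , Pp , below) = p , ℕP.m<1+n⇒m≤n p<1+n , Pp , below

expansion⇒phi : ∀ {n z} → Expansion n z → z ≢ 0ᵍ → Σ ℕ λ p → p ℕ.≤ n × IsPhi z p
expansion⇒phi {z = z} e z≢0 with least (λ k → expansion? k z) e
... | p , p≤n , eₚ , below with expansion⇒hasExp eₚ z≢0
...   | m , m≤p , has with ℕP.m≤n⇒m<n∨m≡n m≤p
...     | inj₁ m<p = ⊥-elim (below m m<p (hasExp⇒expansion has))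
...     | inj₂ refl = m , p≤n , has , λ k k<m hasₖ → below k k<m (hasExp⇒expansion hasₖ)

twice : ℕ → ℕ
twice zero = zero
twice (suc k) = suc (suc (twice k))

level-parity : ∀ n → (Σ ℕ λ k → n ≡ twice k) ⊎ (Σ ℕ λ k → n ≡ suc (twice k))
level-parity zero = inj₁ (0 , refl)
level-parity (suc n) with level-parity n
... | inj₁ (k , refl) = inj₂ (k , refl)
... | inj₂ (k , refl) = inj₁ (suc k , refl)

pow2 : ℕ → ℤ
pow2 k = + (2 ℕ.^ k)

pow2-suc : ∀ k → pow2 (suc k) ≡ pow2 k + pow2 k
pow2-suc k =
  trans (cong (λ m → + (2 ℕ.^ k ℕ.+ m)) (ℕP.+-identityʳ (2 ℕ.^ k))) (ℤP.pos-+ (2 ℕ.^ k) (2 ℕ.^ k))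

1≤pow2 : ∀ k → + 1 ≤ pow2 k
1≤pow2 k = +≤+ (ℕP.m^n>0 2 k)

pow2-mono : ∀ {a b} → a ℕ.≤ b → pow2 a ≤ pow2 b
pow2-mono a≤b = +≤+ (ℕP.^-monoʳ-≤ 2 a≤b)

W-twice : ∀ k → W (twice k) ≡ pow2 k + pow2 k + pow2 k
W-suc-twice : ∀ k → W (suc (twice k)) ≡ pow2 k + pow2 k + pow2 k + pow2 k
W-twice zero = refl
W-twice (suc k) = begin
  W (twice (suc k))                              ≡⟨ W-suc-suc (twice k) ⟩
  W (twice k) + W (twice k)                      ≡⟨ cong₂ _+_ (W-twice k) (W-twice k) ⟩
  (C + C + C) + (C + C + C)                      ≡⟨ regroup C ⟩
  (C + C) + (C + C) + (C + C)                    ≡⟨ cong (λ t → t + t + t) (sym (pow2-suc k)) ⟩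
  pow2 (suc k) + pow2 (suc k) + pow2 (suc k)     ∎
  where
  open ≡-Reasoning
  C = pow2 k
  regroup : ∀ C → (C + C + C) + (C + C + C) ≡ (C + C) + (C + C) + (C + C)
  regroup C = solve (C ∷ [])
W-suc-twice zero = refl
W-suc-twice (suc k) = begin
  W (suc (twice (suc k)))                                    ≡⟨ W-suc-suc (suc (twice k)) ⟩
  W (suc (twice k)) + W (suc (twice k))                      ≡⟨ cong₂ _+_ (W-suc-twice k) (W-suc-twice k) ⟩
  (C + C + C + C) + (C + C + C + C)                          ≡⟨ regroup C ⟩
  (C + C) + (C + C) + (C + C) + (C + C)                      ≡⟨ cong (λ t → t + t + t + t) (sym (pow2-suc k)) ⟩
  pow2 (suc k) + pow2 (suc k) + pow2 (suc k) + pow2 (suc k)  ∎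
  where
  open ≡-Reasoning
  C = pow2 k
  regroup : ∀ C → (C + C + C + C) + (C + C + C + C) ≡ (C + C) + (C + C) + (C + C) + (C + C)
  regroup C = solve (C ∷ [])

W-twice-suc : ∀ k → W (twice (suc k)) ≡ (pow2 k + pow2 k + pow2 k) + (pow2 k + pow2 k + pow2 k)
W-twice-suc k = trans (W-suc-suc (twice k)) (cong₂ _+_ (W-twice k) (W-twice k))

-- Shifting u_b b by 2^(k+1) lowers its level from 2k + 1 to 2k

shift-ineqs : ∀ L Y C → L + + 2 ≤ C + C + C + C → L + Y + + 3 ≤ (C + C + C) + (C + C + C) →
  - Y + L + + 3 ≤ (C + C + C) + (C + C + C) → Y ≤ L → - L ≤ Y → C + C ≤ L → + 2 ≤ C →
  OctagonIneqs (C + C + C) (C + C + C + C) (L - (C + C)) Y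
shift-ineqs L Y C L≤ L+Y≤ -Y+L≤ Y≤L -L≤Y 2C≤L 2≤C = record
  { x≤ = ≤-by _ (gap L≤ ⊕ gap 2≤C ⊕ 0≤+ 2) (solve (L ∷ C ∷ []))
  ; -x≤ = ≤-by _ (gap 2C≤L ⊕ gap 2≤C ⊕ gap 2≤C ⊕ gap 2≤C ⊕ 0≤+ 4) (solve (L ∷ C ∷ []))
  ; y≤ = halve-+3≤ Y (C + C + C) (≤-by _ (gap L+Y≤ ⊕ gap Y≤L) (solve (L ∷ Y ∷ C ∷ [])))
  ; -y≤ = halve-+3≤ (- Y) (C + C + C) (≤-by _ (gap -Y+L≤ ⊕ gap -L≤Y) (solve (L ∷ Y ∷ C ∷ [])))
  ; x+y≤ = ≤-by _ (gap L+Y≤) (solve (L ∷ Y ∷ C ∷ []))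
  ; -x-y≤ = ≤-by _ (gap 2≤C ⊕ gap 2≤C ⊕ 0≤+ 1 ⊕ gap -L≤Y) (solve (L ∷ Y ∷ C ∷ []))
  ; -y+x≤ = ≤-by _ (gap -Y+L≤) (solve (L ∷ Y ∷ C ∷ []))
  ; y-x≤ = ≤-by _ (gap 2≤C ⊕ gap 2≤C ⊕ 0≤+ 1 ⊕ gap Y≤L) (solve (L ∷ Y ∷ C ∷ [])) }

-- If |Y| ≤ L then L² + Y² ≤ 2 L², so a lower bound 4 C L on the norm forces L ≥ 2 C.
norm-bound⇒2C≤L : ∀ L Y C → + 1 ≤ L → Y ≤ L → - L ≤ Y → (C + C + C + C) * L ≤ L * L + Y * Y → C + C ≤ L
norm-bound⇒2C≤L L Y C 1≤L Y≤L -L≤Y bound =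
  double-cancel-≤ (C + C) L (subst (_≤ L + L) 4C≡ (*-cancelˡ-≤-≥1 L (C + C + C + C) (L + L) 1≤L L*4C≤L*2L))
  where
  4C≡ : C + C + C + C ≡ (C + C) + (C + C)
  4C≡ = solve (C ∷ [])
  L+Y≥0 : 0ℤ ≤ L + Y
  L+Y≥0 = ≤-by _ (gap -L≤Y) (solve (L ∷ Y ∷ []))
  L*4C≤L*2L : L * (C + C + C + C) ≤ L * (L + L)
  L*4C≤L*2L = ≤-by _ (gap bound ⊕ gap Y≤L ⊗ L+Y≥0) (solve (L ∷ Y ∷ C ∷ []))

1≤L : ∀ L Y → Y ≤ L → - L ≤ Y → L + Y i ≢ 0ᵍ → + 1 ≤ L
1≤L L Y Y≤L -L≤Y L+Yi≢0 with + 1 ℤ.≤? L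
... | yes 1≤L = 1≤L
... | no 1≰L = ⊥-elim (L+Yi≢0 (cong₂ _+_i L≡0 Y≡0))
  where
  L≤0 : L ≤ 0ℤ
  L≤0 = ≤-by _ (gap (≰⇒+1≤ 1≰L)) (solve (L ∷ []))
  L≡0 : L ≡ 0ℤ
  L≡0 = ℤP.≤-antisym L≤0 (double-cancel-≤ 0ℤ L (≤-by _ (gap Y≤L ⊕ gap -L≤Y) (solve (L ∷ Y ∷ []))))
  Y≡0 : Y ≡ 0ℤ
  Y≡0 = ℤP.≤-antisym (≤-by _ (gap Y≤L ⊕ gap L≤0) (solve (L ∷ Y ∷ [])))
                     (≤-by _ (gap -L≤Y ⊕ gap L≤0) (solve (L ∷ Y ∷ [])))

level1-impossible : ∀ C L Y → C ≡ + 1 → L + + 2 ≤ C + C + C + C → L + Y + + 3 ≤ (C + C + C) + (C + C + C) →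
  - Y + L + + 3 ≤ (C + C + C) + (C + C + C) → C + C ≤ L → ¬ ((C + C + C + C) * L ≤ L * L + Y * Y)
level1-impossible C L Y refl L≤ L+Y≤ -Y+L≤ 2≤L bound = impossible-at-2 (ℤP.≤-antisym L≤2 2≤L)
  where
  L≤2 : L ≤ + 2
  L≤2 = ≤-by _ (gap L≤) (solve (L ∷ []))
  impossible-at-2 : L ≡ + 2 → ⊥
  impossible-at-2 refl = nonneg+1≢0 _ (gap bound ⊕ gap Y≤1 ⊗ gap -1≤Y ⊕ 0≤+ 2) (solve (Y ∷ []))
    where
    Y≤1 : Y ≤ + 1
    Y≤1 = ≤-by _ (gap L+Y≤) (solve (Y ∷ []))
    -1≤Y : - + 1 ≤ Y
    -1≤Y = ≤-by _ (gap -Y+L≤) (solve (Y ∷ []))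

pow2≡1⊎2≤pow2 : ∀ k → pow2 k ≡ + 1 ⊎ + 2 ≤ pow2 k
pow2≡1⊎2≤pow2 zero = inj₁ refl
pow2≡1⊎2≤pow2 (suc k) = inj₂ (subst (+ 2 ≤_) (sym (pow2-suc k)) (ℤP.+-mono-≤ (1≤pow2 k) (1≤pow2 k)))

shift-odd : ∀ k L Y → Odd𝔾 (L + Y i) → Octagon (suc (twice k)) (L + Y i) → - L ≤ Y → Y ≤ L →
  (pow2 k + pow2 k + pow2 k + pow2 k) * L ≤ L * L + Y * Y →
  Region (twice k) ((L - (pow2 k + pow2 k)) + Y i) × (L - (pow2 k + pow2 k)) + Y i ≢ 0ᵍ
shift-odd k L Y odd oct -L≤Y Y≤L bound = [ level1 , higher ]′ (pow2≡1⊎2≤pow2 k)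
  where
  C = pow2 k
  O = octagon⇒bounds {suc (twice k)} oct
  L≤ : L + + 2 ≤ C + C + C + C
  L≤ = subst (L + + 2 ≤_) (W-suc-twice k) (OctagonIneqs.x≤ O)
  L+Y≤ : L + Y + + 3 ≤ (C + C + C) + (C + C + C)
  L+Y≤ = subst (L + Y + + 3 ≤_) (W-twice-suc k) (OctagonIneqs.x+y≤ O)
  -Y+L≤ : - Y + L + + 3 ≤ (C + C + C) + (C + C + C)
  -Y+L≤ = subst (- Y + L + + 3 ≤_) (W-twice-suc k) (OctagonIneqs.-y+x≤ O)
  2C≤L : C + C ≤ L
  2C≤L = norm-bound⇒2C≤L L Y C (1≤L L Y Y≤L -L≤Y (Odd𝔾⇒≢0 odd)) Y≤L -L≤Y bound
  X+2C≡L : ∀ L C → (L - (C + C)) + (C + C) ≡ L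
  X+2C≡L L C = solve (L ∷ C ∷ [])
  shifted-odd : Odd𝔾 ((L - (C + C)) + Y i)
  shifted-odd (X-even , Y-even) = odd (subst Even (X+2C≡L L C) (even+even X-even (C , refl)) , Y-even)
  level1 : C ≡ + 1 → Region (twice k) ((L - (C + C)) + Y i) × (L - (C + C)) + Y i ≢ 0ᵍ
  level1 C≡1 = ⊥-elim (level1-impossible C L Y C≡1 L≤ L+Y≤ -Y+L≤ 2C≤L bound)
  higher : + 2 ≤ C → Region (twice k) ((L - (C + C)) + Y i) × (L - (C + C)) + Y i ≢ 0ᵍ
  higher 2≤C = odd∈ shifted-odd (bounds⇒octagon {twice k}
    (subst₂ (λ A B → OctagonIneqs A B (L - (C + C)) Y) (sym (W-twice k)) (sym (W-suc-twice k))
      (shift-ineqs L Y C L≤ L+Y≤ -Y+L≤ Y≤L -L≤Y 2C≤L 2≤C))) , Odd𝔾⇒≢0 shifted-odd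

halve-norm-bound : ∀ L Y C →
  ((C + C) + (C + C) + (C + C) + (C + C)) * (L + L) ≤ (L + L) * (L + L) + (Y + Y) * (Y + Y) →
  (C + C + C + C) * L ≤ L * L + Y * Y
halve-norm-bound L Y C h = *-cancelˡ-≤-≥1 (+ 4) _ _ (+≤+ (s≤s z≤n)) (≤-by _ (gap h) (solve (L ∷ Y ∷ C ∷ [])))

shift-region : ∀ k L Y → Region (suc (twice k)) (L + Y i) → L + Y i ≢ 0ᵍ → - L ≤ Y → Y ≤ L →
  (pow2 k + pow2 k + pow2 k + pow2 k) * L ≤ L * L + Y * Y →
  Region (twice k) ((L - (pow2 k + pow2 k)) + Y i) × (L - (pow2 k + pow2 k)) + Y i ≢ 0ᵍ
shift-region (suc k) .(L + L) .(Y + Y) (double∈ {z = L + Y i} r) 2z≢0 -2L≤2Y 2Y≤2L bound =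
  subst (Region (twice (suc k))) (sym 2X≡) (double∈ (proj₁ halved)) ,
  λ 2X≡0 → proj₂ halved (double≡0⇒≡0 (trans (sym 2X≡) 2X≡0))
  where
  C = pow2 k
  neg-double : ∀ L → - (L + L) ≡ - L + - L
  neg-double L = solve (L ∷ [])
  halved = shift-region k L Y r (λ z≡0 → 2z≢0 (cong double z≡0))
    (double-cancel-≤ (- L) Y (subst (_≤ Y + Y) (neg-double L) -2L≤2Y)) (double-cancel-≤ Y L 2Y≤2L)
    (halve-norm-bound L Y C (subst (λ C′ → (C′ + C′ + C′ + C′) * (L + L) ≤ (L + L) * (L + L) + (Y + Y) * (Y + Y))
                                   (pow2-suc k) bound))
  doubled : ∀ L C → (L + L) - ((C + C) + (C + C)) ≡ (L - (C + C)) + (L - (C + C))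
  doubled L C = solve (L ∷ C ∷ [])
  2X≡ : ((L + L) - (pow2 (suc k) + pow2 (suc k))) + (Y + Y) i ≡ double ((L - (C + C)) + Y i)
  2X≡ = cong₂ _+_i (trans (cong (λ C′ → (L + L) - (C′ + C′)) (pow2-suc k)) (doubled L C)) refl
shift-region k L Y zero∈ L+Yi≢0 _ _ _ = ⊥-elim (L+Yi≢0 refl)
shift-region k L Y (odd∈ odd oct) _ = shift-odd k L Y odd oct

-- The Gauss remainder

-- |ρ| ≤ N / 2, stated without division
HalfBounded : ℤ → ℤ → Set
HalfBounded N ρ = - N ≤ ρ + ρ × ρ + ρ ≤ N

HalfBounded² : ℤ → 𝔾 → Set
HalfBounded² N z = HalfBounded N (re z) × HalfBounded N (im z)

halfBounded-down : ∀ p r q N → p ≡ r + q * N → 0ℤ ≤ r → r + r ≤ N → HalfBounded N (p - q * N)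
halfBounded-down p r q N p≡ 0≤r 2r≤N =
  subst (HalfBounded N) (sym (trans (cong (_- q * N) p≡) (cancel r q N)))
    (≤-by _ (gap 2r≤N ⊕ 0≤r ⊕ 0≤r ⊕ 0≤r ⊕ 0≤r) (solve (N ∷ r ∷ [])) , 2r≤N)
  where
  cancel : ∀ r q N → r + q * N - q * N ≡ r
  cancel r q N = solve (r ∷ q ∷ N ∷ [])

halfBounded-up : ∀ p r q N → p ≡ r + q * N → N + + 1 ≤ r + r → r + + 1 ≤ N → HalfBounded N (p - (q + + 1) * N)
halfBounded-up p r q N p≡ N<2r r<N =
  subst (HalfBounded N) (sym (trans (cong (_- (q + + 1) * N) p≡) (cancel r q N)))
    (≤-by _ (gap N<2r ⊕ 0≤+ 1) (solve (N ∷ r ∷ [])) ,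
     ≤-by _ (gap r<N ⊕ gap r<N ⊕ gap r<N ⊕ gap r<N ⊕ gap N<2r ⊕ 0≤+ 5) (solve (N ∷ r ∷ [])))
  where
  cancel : ∀ r q N → r + q * N - (q + + 1) * N ≡ r - N
  cancel r q N = solve (r ∷ q ∷ N ∷ [])

if-does : ∀ {P : Set} (d : Dec P) {A : Set} (x y : A) →
  P × (if does d then x else y) ≡ x ⊎ ¬ P × (if does d then x else y) ≡ y
if-does (yes p) x y = inj₁ (p , refl)
if-does (no ¬p) x y = inj₂ (¬p , refl)

roundDiv-halfBounded : ∀ p n → 1 ℕ.≤ n → HalfBounded (+ n) (p - roundDiv p n * + n)
roundDiv-halfBounded p (suc k) _ = rounded (if-does ((2 ℕ.* r) ℕ.≤? suc k) q (q + + 1))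
  where
  r = p ℤ.%ℕ suc k
  q = p ℤ./ℕ suc k
  N = + suc k
  p≡ : p ≡ + r + q * N
  p≡ = ℤD.a≡a%ℕn+[a/ℕn]*n p (suc k)
  +-double : ∀ m → + (2 ℕ.* m) ≡ + m + + m
  +-double m = trans (cong (λ t → + (m ℕ.+ t)) (ℕP.+-identityʳ m)) (ℤP.pos-+ m m)
  +-suc : ∀ m → + suc m ≡ + m + + 1
  +-suc m = trans (cong +_ (ℕP.+-comm 1 m)) (ℤP.pos-+ m 1)
  rounded : 2 ℕ.* r ℕ.≤ suc k × roundDiv p (suc k) ≡ q ⊎
            ¬ (2 ℕ.* r ℕ.≤ suc k) × roundDiv p (suc k) ≡ q + + 1 →
            HalfBounded N (p - roundDiv p (suc k) * N)
  rounded (inj₁ (2r≤N , rounded≡q)) = subst (λ t → HalfBounded N (p - t * N)) (sym rounded≡q)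
    (halfBounded-down p (+ r) q N p≡ (0≤+ r) (subst (_≤ N) (+-double r) (+≤+ 2r≤N)))
  rounded (inj₂ (2r≰N , rounded≡q+1)) = subst (λ t → HalfBounded N (p - t * N)) (sym rounded≡q+1)
    (halfBounded-up p (+ r) q N p≡ (subst₂ _≤_ (+-suc (suc k)) (+-double r) (+≤+ (ℕP.≰⇒> 2r≰N)))
      (subst (_≤ N) (+-suc r) (+≤+ (ℤD.n%ℕd<d p (suc k)))))

Nℤ : 𝔾 → ℤ
Nℤ z = re z * re z + im z * im z

square-nonneg : ∀ t → 0ℤ ≤ t * t
square-nonneg (+ n) = subst (0ℤ ≤_) (ℤP.pos-* n n) (0≤+ (n ℕ.* n))
square-nonneg -[1+ n ] = 0≤+ _

+Nm≡Nℤ : ∀ z → + Nm z ≡ Nℤ z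
+Nm≡Nℤ (x + y i) = ℤP.0≤i⇒+∣i∣≡i (square-nonneg x ⊕ square-nonneg y)

1≤square : ∀ t → t ≢ 0ℤ → + 1 ≤ t * t
1≤square (+ zero) t≢0 = ⊥-elim (t≢0 refl)
1≤square (+ suc n) _ = +≤+ (s≤s z≤n)
1≤square -[1+ n ] _ = +≤+ (s≤s z≤n)

1≤Nℤ : ∀ {z} → z ≢ 0ᵍ → + 1 ≤ Nℤ z
1≤Nℤ {x + y i} z≢0 with x ℤP.≟ 0ℤ | y ℤP.≟ 0ℤ
... | yes refl | yes refl = ⊥-elim (z≢0 refl)
... | no x≢0 | _ = ℤP.+-mono-≤ (1≤square x x≢0) (square-nonneg y)
... | yes _ | no y≢0 = ℤP.+-mono-≤ (square-nonneg x) (1≤square y y≢0)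

remainder*conj : ∀ a q b → (a -ᵍ q *ᵍ b) *ᵍ conj b ≡
  (re (a *ᵍ conj b) - re q * Nℤ b) + (im (a *ᵍ conj b) - im q * Nℤ b) i
remainder*conj (a₁ + a₂ i) (q₁ + q₂ i) (b₁ + b₂ i) = cong₂ _+_i re≡ im≡
  where
  re≡ : (a₁ + - (q₁ * b₁ - q₂ * b₂)) * b₁ - (a₂ + - (q₁ * b₂ + q₂ * b₁)) * - b₂ ≡
        (a₁ * b₁ - a₂ * - b₂) - q₁ * (b₁ * b₁ + b₂ * b₂)
  re≡ = solve (a₁ ∷ a₂ ∷ q₁ ∷ q₂ ∷ b₁ ∷ b₂ ∷ [])
  im≡ : (a₁ + - (q₁ * b₁ - q₂ * b₂)) * - b₂ + (a₂ + - (q₁ * b₂ + q₂ * b₁)) * b₁ ≡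
        (a₁ * - b₂ + a₂ * b₁) - q₂ * (b₁ * b₁ + b₂ * b₂)
  im≡ = solve (a₁ ∷ a₂ ∷ q₁ ∷ q₂ ∷ b₁ ∷ b₂ ∷ [])

-- Both coordinates of r b̄ are p - ⌊p / N(b)⌉ N(b) for p a coordinate of a b̄.
gaussRem-halfBounded : ∀ a b → b ≢ 0ᵍ → HalfBounded² (Nℤ b) (gaussRem a b *ᵍ conj b)
gaussRem-halfBounded a b b≢0 = subst (HalfBounded² (Nℤ b)) (sym (remainder*conj a (gaussQuot a b) b))
  (rounded (re (a *ᵍ conj b)) , rounded (im (a *ᵍ conj b)))
  where
  1≤Nm : 1 ℕ.≤ Nm b
  1≤Nm = ℤP.drop‿+≤+ (subst (+ 1 ≤_) (sym (+Nm≡Nℤ b)) (1≤Nℤ b≢0))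
  rounded : ∀ p → HalfBounded (Nℤ b) (p - roundDiv p (Nm b) * Nℤ b)
  rounded p = subst (λ N → HalfBounded N (p - roundDiv p (Nm b) * N)) (+Nm≡Nℤ b)
    (roundDiv-halfBounded p (Nm b) 1≤Nm)

halfBounded-neg : ∀ {N ρ} → HalfBounded N ρ → HalfBounded N (- ρ)
halfBounded-neg {N} {ρ} (lo , hi) = ≤-by _ (gap hi) (solve (N ∷ ρ ∷ [])) , ≤-by _ (gap lo) (solve (N ∷ ρ ∷ []))

halfBounded-neg⁻¹ : ∀ {N ρ} → HalfBounded N (- ρ) → HalfBounded N ρ
halfBounded-neg⁻¹ {N} {ρ} hb = subst (HalfBounded N) (ℤP.neg-involutive ρ) (halfBounded-neg {N} { - ρ} hb)

halfBounded²-unit*⁻¹ : ∀ {N u z} → IsUnit u → HalfBounded² N (u *ᵍ z) → HalfBounded² N z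
halfBounded²-unit*⁻¹ {N} {z = z} u1 hb = subst (HalfBounded² N) (*ᵍ-identityˡ z) hb
halfBounded²-unit*⁻¹ {N} {z = x + y i} u-1 hb with subst (HalfBounded² N) (-1*ᵍ x y) hb
... | hb-x , hb-y = halfBounded-neg⁻¹ {N} {x} hb-x , halfBounded-neg⁻¹ {N} {y} hb-y
halfBounded²-unit*⁻¹ {N} {z = x + y i} ui hb with subst (HalfBounded² N) (i*ᵍ x y) hb
... | hb-y , hb-x = hb-x , halfBounded-neg⁻¹ {N} {y} hb-y
halfBounded²-unit*⁻¹ {N} {z = x + y i} u-i hb with subst (HalfBounded² N) (-i*ᵍ x y) hb
... | hb-y , hb-x = halfBounded-neg⁻¹ {N} {x} hb-x , hb-y

halfBounded²-norm : ∀ {N M z} → HalfBounded² N z → + 1 ≤ N → Nℤ z ≡ M * N → M + M ≤ N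
halfBounded²-norm {N} {M} {ρ₁ + ρ₂ i} ((lo₁ , hi₁) , (lo₂ , hi₂)) 1≤N Nz≡ =
  double-cancel-≤ (M + M) N (subst (_≤ N + N) 4M≡ (*-cancelˡ-≤-≥1 N (M + M + M + M) (N + N) 1≤N N*4M≤N*2N))
  where
  4M≡ : M + M + M + M ≡ (M + M) + (M + M)
  4M≡ = solve (M ∷ [])
  Nz≥ : 0ℤ ≤ (ρ₁ * ρ₁ + ρ₂ * ρ₂) - M * N
  Nz≥ = gap (ℤP.≤-reflexive (sym Nz≡))
  N*4M≤N*2N : N * (M + M + M + M) ≤ N * (N + N)
  N*4M≤N*2N = ≤-by _ (gap hi₁ ⊗ gap lo₁ ⊕ gap hi₂ ⊗ gap lo₂ ⊕ Nz≥ ⊕ Nz≥ ⊕ Nz≥ ⊕ Nz≥)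
    (solve (ρ₁ ∷ ρ₂ ∷ N ∷ M ∷ []))

Nℤ-*ᵍ : ∀ z w → Nℤ (z *ᵍ w) ≡ Nℤ z * Nℤ w
Nℤ-*ᵍ (x + y i) (u + v i) = product
  where
  product : (x * u - y * v) * (x * u - y * v) + (x * v + y * u) * (x * v + y * u) ≡ (x * x + y * y) * (u * u + v * v)
  product = solve (x ∷ y ∷ u ∷ v ∷ [])

Nℤ-conj : ∀ z → Nℤ (conj z) ≡ Nℤ z
Nℤ-conj (x + y i) = cong (λ t → x * x + t) (neg*neg y)
  where
  neg*neg : ∀ y → - y * - y ≡ y * y
  neg*neg y = solve (y ∷ [])

abs-square : ∀ x → + ℤ.∣ x ∣ * + ℤ.∣ x ∣ ≡ x * x
abs-square (+ n) = refl
abs-square -[1+ n ] = refl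

octagon-abs : ∀ {A B x y} → OctagonIneqs A B x y →
  (+ ℤ.∣ x ∣ + + 2 ≤ A) × (+ ℤ.∣ y ∣ + + 2 ≤ A) × (+ ℤ.∣ x ∣ + + ℤ.∣ y ∣ + + 3 ≤ B)
octagon-abs {A} {B} {x} {y} O = by-sign (ℤP.+∣i∣≡i⊎+∣i∣≡-i x) O.x≤ O.-x≤ ,
  by-sign (ℤP.+∣i∣≡i⊎+∣i∣≡-i y) O.y≤ O.-y≤ ,
  diagonal (ℤP.+∣i∣≡i⊎+∣i∣≡-i x) (ℤP.+∣i∣≡i⊎+∣i∣≡-i y)
  where
  module O = OctagonIneqs O
  by-sign : ∀ {t a} → a ≡ t ⊎ a ≡ - t → t + + 2 ≤ A → - t + + 2 ≤ A → a + + 2 ≤ A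
  by-sign (inj₁ refl) t≤ _ = t≤
  by-sign (inj₂ refl) _ -t≤ = -t≤
  diagonal : ∀ {a b} → a ≡ x ⊎ a ≡ - x → b ≡ y ⊎ b ≡ - y → a + b + + 3 ≤ B
  diagonal (inj₁ refl) (inj₁ refl) = O.x+y≤
  diagonal (inj₁ refl) (inj₂ refl) = subst (λ t → t + + 3 ≤ B) (ℤP.+-comm (- y) x) O.-y+x≤
  diagonal (inj₂ refl) (inj₁ refl) = subst (λ t → t + + 3 ≤ B) (ℤP.+-comm y (- x)) O.y-x≤
  diagonal (inj₂ refl) (inj₂ refl) = O.-x-y≤

octagon-norm≤ℓ₁ : ∀ {A B x y} → OctagonIneqs A B x y → x * x + y * y ≤ (A - + 2) * (+ ℤ.∣ x ∣ + + ℤ.∣ y ∣)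
octagon-norm≤ℓ₁ {A} {B} {x} {y} O with octagon-abs O
... | ∣x∣≤ , ∣y∣≤ , _ = subst₂ (λ s t → s + t ≤ (A - + 2) * (+ ℤ.∣ x ∣ + + ℤ.∣ y ∣)) (abs-square x) (abs-square y)
  (bound (+ ℤ.∣ x ∣) (+ ℤ.∣ y ∣) A (0≤+ _) (0≤+ _) ∣x∣≤ ∣y∣≤)
  where
  bound : ∀ a b A → 0ℤ ≤ a → 0ℤ ≤ b → a + + 2 ≤ A → b + + 2 ≤ A → a * a + b * b ≤ (A - + 2) * (a + b)
  bound a b A 0≤a 0≤b a≤ b≤ = ≤-by _ (0≤a ⊗ gap a≤ ⊕ 0≤b ⊗ gap b≤) (solve (a ∷ b ∷ A ∷ []))

octagon-norm<A*B : ∀ {A B x y} → OctagonIneqs A B x y → x * x + y * y + + 1 ≤ A * B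
octagon-norm<A*B {A} {B} {x} {y} O with octagon-abs O
... | ∣x∣≤ , ∣y∣≤ , ∣x∣+∣y∣≤ = subst₂ (λ s t → s + t + + 1 ≤ A * B) (abs-square x) (abs-square y)
  (bound (+ ℤ.∣ x ∣) (+ ℤ.∣ y ∣) A B (0≤+ _) (0≤+ _) ∣x∣≤ ∣y∣≤ ∣x∣+∣y∣≤)
  where
  bound : ∀ a b A B → 0ℤ ≤ a → 0ℤ ≤ b → a + + 2 ≤ A → b + + 2 ≤ A → a + b + + 3 ≤ B → a * a + b * b + + 1 ≤ A * B
  bound a b A B 0≤a 0≤b a≤ b≤ a+b≤ =
    ≤-by _ (0≤a ⊗ gap a≤ ⊕ 0≤b ⊗ gap b≤ ⊕ (0≤a ⊕ gap a≤) ⊗ gap a+b≤ ⊕ 0≤a ⊕ 0≤a ⊕ 0≤a ⊕ gap a≤ ⊕ gap a≤ ⊕ gap a≤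
              ⊕ 0≤a ⊕ 0≤a ⊕ 0≤b ⊕ 0≤b ⊕ gap a+b≤ ⊕ gap a+b≤ ⊕ 0≤+ 5) (solve (a ∷ b ∷ A ∷ B ∷ []))

-- The remainder is a unit times 2^(k+1), at level n = 2k + 1

4C²*-nonneg : ∀ {C t} → 0ℤ ≤ C → 0ℤ ≤ t → 0ℤ ≤ (C + C) * (C + C) * t
4C²*-nonneg 0≤C 0≤t = ((0≤C ⊕ 0≤C) ⊗ (0≤C ⊕ 0≤C)) ⊗ 0≤t

-- At level 2k + 1, with C = 2^k, the octagon bound reads N(b) < 24 C².
remainder-too-large : ∀ C D Nc Nb → + 1 ≤ C → C + C + C + C ≤ D → + 1 ≤ Nc → D * D * Nc + D * D * Nc ≤ Nb →
  ¬ (Nb + + 1 ≤ (C + C + C + C) * ((C + C + C) + (C + C + C)))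
remainder-too-large C D Nc Nb 1≤C 4C≤D 1≤Nc 2D²Nc≤Nb Nb<24C² = nonneg+1≢0 _
  (gap Nb<24C² ⊕ gap 2D²Nc≤Nb ⊕ (0≤D ⊗ 0≤D) ⊗ gap 1≤Nc ⊕ (0≤D ⊗ 0≤D) ⊗ gap 1≤Nc
    ⊕ gap 4C≤D ⊗ 0≤D+4C ⊕ gap 4C≤D ⊗ 0≤D+4C ⊕ 4C²*-nonneg 0≤C (0≤+ 1) ⊕ 4C²*-nonneg 0≤C (0≤+ 1))
  (solve (C ∷ D ∷ Nc ∷ Nb ∷ []))
  where
  0≤C : 0ℤ ≤ C
  0≤C = ℤP.≤-trans (0≤+ 1) 1≤C
  0≤D : 0ℤ ≤ D
  0≤D = ℤP.≤-trans (0≤C ⊕ 0≤C ⊕ 0≤C ⊕ 0≤C) 4C≤D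
  0≤D+4C : 0ℤ ≤ D + (C + C + C + C)
  0≤D+4C = 0≤D ⊕ (0≤C ⊕ 0≤C ⊕ 0≤C ⊕ 0≤C)

exact-level⇒norm≤2 : ∀ C Nc Nb → + 1 ≤ C → (C + C) * (C + C) * Nc + (C + C) * (C + C) * Nc ≤ Nb →
  Nb + + 1 ≤ (C + C + C + C) * ((C + C + C) + (C + C + C)) → Nc ≤ + 2
exact-level⇒norm≤2 C Nc Nb 1≤C 8C²Nc≤Nb Nb<24C² = ℤP.≮⇒≥ λ 2<Nc → ¬3≤Nc (<⇒+1≤ 2<Nc)
  where
  0≤C : 0ℤ ≤ C
  0≤C = ℤP.≤-trans (0≤+ 1) 1≤C
  ¬3≤Nc : ¬ (+ 3 ≤ Nc)
  ¬3≤Nc 3≤Nc = nonneg+1≢0 _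
    (gap Nb<24C² ⊕ gap 8C²Nc≤Nb ⊕ 4C²*-nonneg 0≤C (gap 3≤Nc) ⊕ 4C²*-nonneg 0≤C (gap 3≤Nc))
    (solve (C ∷ Nc ∷ Nb ∷ []))

12C²≤24C² : ∀ C → + 1 ≤ C → (C + C + C) * (C + C + C + C) ≤ (C + C + C + C) * ((C + C + C) + (C + C + C))
12C²≤24C² C 1≤C = ≤-by _ (0≤C ⊗ 0≤C ⊕ 0≤C ⊗ 0≤C ⊕ 0≤C ⊗ 0≤C ⊕ 0≤C ⊗ 0≤C ⊕ 0≤C ⊗ 0≤C ⊕ 0≤C ⊗ 0≤C
  ⊕ 0≤C ⊗ 0≤C ⊕ 0≤C ⊗ 0≤C ⊕ 0≤C ⊗ 0≤C ⊕ 0≤C ⊗ 0≤C ⊕ 0≤C ⊗ 0≤C ⊕ 0≤C ⊗ 0≤C) (solve (C ∷ []))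
  where
  0≤C : 0ℤ ≤ C
  0≤C = ℤP.≤-trans (0≤+ 1) 1≤C

4≤square : ∀ m → + 4 ≤ + suc (suc m) * + suc (suc m)
4≤square m = +≤+ (ℕP.*-mono-≤ {2} {suc (suc m)} (s≤s (s≤s z≤n)) (s≤s (s≤s z≤n)))

square≤2 : ∀ t → t * t ≤ + 2 → t ≡ 0ℤ ⊎ t ≡ + 1 ⊎ t ≡ - + 1
square≤2 (+ 0) _ = inj₁ refl
square≤2 (+ 1) _ = inj₂ (inj₁ refl)
square≤2 (+ suc (suc m)) t²≤2 = ⊥-elim (ℤP.≤⇒≤ᵇ (ℤP.≤-trans (4≤square m) t²≤2))
square≤2 -[1+ 0 ] _ = inj₂ (inj₂ refl)
square≤2 -[1+ suc m ] t²≤2 = ⊥-elim (ℤP.≤⇒≤ᵇ (ℤP.≤-trans (4≤square m) t²≤2))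

summand≤ : ∀ a b → a * a + b * b ≤ + 2 → a * a ≤ + 2
summand≤ a b h = ≤-by _ (gap h ⊕ square-nonneg b) (solve (a ∷ b ∷ []))

small-odd : ∀ {c} → Odd𝔾 c → Nℤ c ≤ + 2 → IsUnit c ⊎ Σ 𝔾 λ u → IsUnit u × c ≡ u *ᵍ 1+i
small-odd {x + y i} odd N≤2
  with square≤2 x (summand≤ x y N≤2)
     | square≤2 y (summand≤ y x (subst (_≤ + 2) (ℤP.+-comm (x * x) (y * y)) N≤2))
... | inj₁ refl | inj₁ refl = ⊥-elim (odd ((0ℤ , refl) , (0ℤ , refl)))
... | inj₂ (inj₁ refl) | inj₁ refl = inj₁ u1
... | inj₂ (inj₂ refl) | inj₁ refl = inj₁ u-1
... | inj₁ refl | inj₂ (inj₁ refl) = inj₁ ui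
... | inj₁ refl | inj₂ (inj₂ refl) = inj₁ u-i
... | inj₂ (inj₁ refl) | inj₂ (inj₁ refl) = inj₂ (1ᵍ , u1 , refl)
... | inj₂ (inj₁ refl) | inj₂ (inj₂ refl) = inj₂ (-iᵍ , u-i , refl)
... | inj₂ (inj₂ refl) | inj₂ (inj₁ refl) = inj₂ (iᵍ , ui , refl)
... | inj₂ (inj₂ refl) | inj₂ (inj₂ refl) = inj₂ (-1ᵍ , u-1 , refl)

fromℕ-*ᵍ : ∀ m n → fromℕ m *ᵍ fromℕ n ≡ fromℕ (m ℕ.* n)
fromℕ-*ᵍ m n = cong₂ _+_i (trans (ℤP.+-identityʳ (+ m * + n)) (sym (ℤP.pos-* m n)))
                         (trans (ℤP.+-identityʳ (+ m * + 0)) (ℤP.*-zeroʳ (+ m)))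

fromℕ2^ᵍ : ∀ v → fromℕ 2 ^ᵍ v ≡ fromℕ (2 ℕ.^ v)
fromℕ2^ᵍ zero = refl
fromℕ2^ᵍ (suc v) = trans (cong (fromℕ 2 *ᵍ_) (fromℕ2^ᵍ v)) (fromℕ-*ᵍ 2 (2 ℕ.^ v))

2^v∤m*2^K⇒K<v : ∀ v K m → ¬ (fromℕ 2 ^ᵍ v ∣ᵍ fromℕ (m ℕ.* 2 ℕ.^ K)) → K ℕ.< v
2^v∤m*2^K⇒K<v v K m 2^v∤ with v ℕ.≤? K
... | no v≰K = ℕP.≰⇒> v≰K
... | yes v≤K = ⊥-elim (2^v∤ (fromℕ (m ℕ.* 2 ℕ.^ (K ℕ.∸ v)) , divides))
  where
  open ≡-Reasoning
  m*2^K≡ : m ℕ.* 2 ℕ.^ K ≡ m ℕ.* 2 ℕ.^ (K ℕ.∸ v) ℕ.* 2 ℕ.^ v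
  m*2^K≡ = begin
    m ℕ.* 2 ℕ.^ K                           ≡⟨ cong (λ e → m ℕ.* 2 ℕ.^ e) (sym (ℕP.m+[n∸m]≡n v≤K)) ⟩
    m ℕ.* 2 ℕ.^ (v ℕ.+ (K ℕ.∸ v))           ≡⟨ cong (m ℕ.*_) (ℕP.^-distribˡ-+-* 2 v (K ℕ.∸ v)) ⟩
    m ℕ.* (2 ℕ.^ v ℕ.* 2 ℕ.^ (K ℕ.∸ v))     ≡⟨ cong (m ℕ.*_) (ℕP.*-comm (2 ℕ.^ v) (2 ℕ.^ (K ℕ.∸ v))) ⟩
    m ℕ.* (2 ℕ.^ (K ℕ.∸ v) ℕ.* 2 ℕ.^ v)     ≡⟨ sym (ℕP.*-assoc m (2 ℕ.^ (K ℕ.∸ v)) (2 ℕ.^ v)) ⟩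
    m ℕ.* 2 ℕ.^ (K ℕ.∸ v) ℕ.* 2 ℕ.^ v       ∎
  divides : fromℕ (m ℕ.* 2 ℕ.^ (K ℕ.∸ v)) *ᵍ fromℕ 2 ^ᵍ v ≡ fromℕ (m ℕ.* 2 ℕ.^ K)
  divides = begin
    fromℕ (m ℕ.* 2 ℕ.^ (K ℕ.∸ v)) *ᵍ fromℕ 2 ^ᵍ v        ≡⟨ cong (fromℕ (m ℕ.* 2 ℕ.^ (K ℕ.∸ v)) *ᵍ_) (fromℕ2^ᵍ v) ⟩
    fromℕ (m ℕ.* 2 ℕ.^ (K ℕ.∸ v)) *ᵍ fromℕ (2 ℕ.^ v)     ≡⟨ fromℕ-*ᵍ (m ℕ.* 2 ℕ.^ (K ℕ.∸ v)) (2 ℕ.^ v) ⟩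
    fromℕ (m ℕ.* 2 ℕ.^ (K ℕ.∸ v) ℕ.* 2 ℕ.^ v)            ≡⟨ cong fromℕ (sym m*2^K≡) ⟩
    fromℕ (m ℕ.* 2 ℕ.^ K)                               ∎

w-suc-twice : ∀ k → w (suc (twice k)) ≡ 2 ℕ.^ suc (suc k)
w-suc-twice zero = refl
w-suc-twice (suc k) = cong (2 ℕ.*_) (w-suc-twice k)

w-twice : ∀ k → w (twice k) ≡ 3 ℕ.* 2 ℕ.^ k
w-twice zero = refl
w-twice (suc k) =
  trans (cong (2 ℕ.*_) (w-twice k)) (trans (sym (ℕP.*-assoc 2 3 (2 ℕ.^ k))) (ℕP.*-assoc 3 2 (2 ℕ.^ k)))

wPred-twice : ∀ k → wPred (twice k) ≡ 1 ℕ.* 2 ℕ.^ suc k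
wPred-twice zero = refl
wPred-twice (suc k) = trans (w-suc-twice k) (sym (ℕP.*-identityˡ _))

wPred-suc-twice : ∀ k → wPred (suc (twice k)) ≡ 3 ℕ.* 2 ℕ.^ k
wPred-suc-twice = w-twice

*ᵍ-2* : ∀ w p → w *ᵍ (fromℕ 2 *ᵍ p) ≡ double w *ᵍ p
*ᵍ-2* (w₁ + w₂ i) (p₁ + p₂ i) = cong₂ _+_i re≡ im≡
  where
  re≡ : w₁ * (+ 2 * p₁ - + 0 * p₂) - w₂ * (+ 2 * p₂ + + 0 * p₁) ≡ (w₁ + w₁) * p₁ - (w₂ + w₂) * p₂
  re≡ = solve (w₁ ∷ w₂ ∷ p₁ ∷ p₂ ∷ [])
  im≡ : w₁ * (+ 2 * p₂ + + 0 * p₁) + w₂ * (+ 2 * p₁ - + 0 * p₂) ≡ (w₁ + w₁) * p₂ + (w₂ + w₂) * p₁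
  im≡ = solve (w₁ ∷ w₂ ∷ p₁ ∷ p₂ ∷ [])

odd-part : ∀ {r v} → IsV2 r v → Σ 𝔾 λ c → r ≡ c *ᵍ fromℕ (2 ℕ.^ v) × Odd𝔾 c
odd-part {r} {v} ((c , c*2^v≡r) , 2^[v+1]∤r) = c , trans (sym c*2^v≡r) (cong (c *ᵍ_) (fromℕ2^ᵍ v)) , c-odd
  where
  c-odd : Odd𝔾 c
  c-odd ((s₁ , c₁≡) , (s₂ , c₂≡)) = 2^[v+1]∤r (s₁ + s₂ i ,
    trans (*ᵍ-2* (s₁ + s₂ i) (fromℕ 2 ^ᵍ v))
          (trans (cong (_*ᵍ fromℕ 2 ^ᵍ v) (sym (cong₂ _+_i c₁≡ c₂≡))) c*2^v≡r))

diagonal-components : ∀ Dz x y → (1+i *ᵍ fromℤ Dz) *ᵍ conj (x + y i) ≡ (Dz * x + Dz * y) + (Dz * x - Dz * y) i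
diagonal-components Dz x y = cong₂ _+_i re≡ im≡
  where
  re≡ : (+ 1 * Dz - + 1 * + 0) * x - (+ 1 * + 0 + + 1 * Dz) * - y ≡ Dz * x + Dz * y
  re≡ = solve (Dz ∷ x ∷ y ∷ [])
  im≡ : (+ 1 * Dz - + 1 * + 0) * - y + (+ 1 * + 0 + + 1 * Dz) * x ≡ Dz * x - Dz * y
  im≡ = solve (Dz ∷ x ∷ y ∷ [])

diagonal-bound : ∀ N Dz x y → HalfBounded N (Dz * x + Dz * y) → HalfBounded N (Dz * x - Dz * y) →
  (Dz + Dz) * (+ ℤ.∣ x ∣ + + ℤ.∣ y ∣) ≤ N
diagonal-bound N Dz x y (lo₁ , hi₁) (lo₂ , hi₂) = by-signs (ℤP.+∣i∣≡i⊎+∣i∣≡-i x) (ℤP.+∣i∣≡i⊎+∣i∣≡-i y)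
  where
  by-signs : ∀ {a b} → a ≡ x ⊎ a ≡ - x → b ≡ y ⊎ b ≡ - y → (Dz + Dz) * (a + b) ≤ N
  by-signs (inj₁ refl) (inj₁ refl) = ≤-by _ (gap hi₁) (solve (N ∷ Dz ∷ x ∷ y ∷ []))
  by-signs (inj₁ refl) (inj₂ refl) = ≤-by _ (gap hi₂) (solve (N ∷ Dz ∷ x ∷ y ∷ []))
  by-signs (inj₂ refl) (inj₁ refl) = ≤-by _ (gap lo₂) (solve (N ∷ Dz ∷ x ∷ y ∷ []))
  by-signs (inj₂ refl) (inj₂ refl) = ≤-by _ (gap lo₁) (solve (N ∷ Dz ∷ x ∷ y ∷ []))

scalar-components : ∀ Dz x y → fromℤ Dz *ᵍ conj (x + y i) ≡ (Dz * x) + (- (Dz * y)) i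
scalar-components Dz x y = cong₂ _+_i re≡ im≡
  where
  re≡ : Dz * x - + 0 * - y ≡ Dz * x
  re≡ = solve (Dz ∷ x ∷ y ∷ [])
  im≡ : Dz * - y + + 0 * x ≡ - (Dz * y)
  im≡ = solve (Dz ∷ x ∷ y ∷ [])

scaled-abs-bound : ∀ N Dz t → HalfBounded N (Dz * t) → (Dz + Dz) * + ℤ.∣ t ∣ ≤ N
scaled-abs-bound N Dz t hb = by-sign hb (ℤP.+∣i∣≡i⊎+∣i∣≡-i t)
  where
  by-sign : HalfBounded N (Dz * t) → ∀ {a} → a ≡ t ⊎ a ≡ - t → (Dz + Dz) * a ≤ N
  by-sign (_ , hi) (inj₁ refl) = ≤-by _ (gap hi) (solve (N ∷ Dz ∷ t ∷ []))
  by-sign (lo , _) (inj₂ refl) = ≤-by _ (gap lo) (solve (N ∷ Dz ∷ t ∷ []))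

scalar-bound : ∀ N Dz x y → HalfBounded N (Dz * x) → HalfBounded N (Dz * y) →
  (Dz + Dz) * + (ℤ.∣ x ∣ ℕ.⊔ ℤ.∣ y ∣) ≤ N
scalar-bound N Dz x y hb-x hb-y with ℕP.⊔-sel ℤ.∣ x ∣ ℤ.∣ y ∣
... | inj₁ ⊔≡ = subst (λ m → (Dz + Dz) * + m ≤ N) (sym ⊔≡) (scaled-abs-bound N Dz x hb-x)
... | inj₂ ⊔≡ = subst (λ m → (Dz + Dz) * + m ≤ N) (sym ⊔≡) (scaled-abs-bound N Dz y hb-y)

mᵍ-unit*fromℕ : ∀ {u} → IsUnit u → ∀ D → mᵍ (u *ᵍ fromℕ D) ≡ 0
mᵍ-unit*fromℕ u1 D = trans (cong mᵍ (*ᵍ-identityˡ (fromℕ D))) (ℕP.⊓-zeroʳ D)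
mᵍ-unit*fromℕ u-1 D = trans (cong mᵍ (-1*ᵍ (+ D) 0ℤ)) (ℕP.⊓-zeroʳ ℤ.∣ - + D ∣)
mᵍ-unit*fromℕ ui D = cong mᵍ (i*ᵍ (+ D) 0ℤ)
mᵍ-unit*fromℕ u-i D = cong mᵍ (-i*ᵍ (+ D) 0ℤ)

ℓ∞-unit*fromℕ : ∀ {u} → IsUnit u → ∀ D → ℓ∞ (u *ᵍ fromℕ D) ≡ D
ℓ∞-unit*fromℕ u1 D = trans (cong ℓ∞ (*ᵍ-identityˡ (fromℕ D))) (ℕP.⊔-identityʳ D)
ℓ∞-unit*fromℕ u-1 D =
  trans (cong ℓ∞ (-1*ᵍ (+ D) 0ℤ)) (trans (ℕP.⊔-identityʳ ℤ.∣ - + D ∣) (ℤP.∣-i∣≡∣i∣ (+ D)))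
ℓ∞-unit*fromℕ ui D = cong ℓ∞ (i*ᵍ (+ D) 0ℤ)
ℓ∞-unit*fromℕ u-i D = trans (cong ℓ∞ (-i*ᵍ (+ D) 0ℤ)) (ℤP.∣-i∣≡∣i∣ (+ D))

unit*fromℕ-re : ∀ {e} → IsUnit e → ∀ D → D ≢ 0 → re (e *ᵍ fromℕ D) ≡ + D → e *ᵍ fromℕ D ≡ fromℕ D
unit*fromℕ-re u1 D _ _ = *ᵍ-identityˡ (fromℕ D)
unit*fromℕ-re u-1 zero 0≢0 _ = ⊥-elim (0≢0 refl)
unit*fromℕ-re u-1 (suc d) _ re≡ with trans (sym (cong re (-1*ᵍ (+ suc d) 0ℤ))) re≡
... | ()
unit*fromℕ-re ui zero 0≢0 _ = ⊥-elim (0≢0 refl)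
unit*fromℕ-re ui (suc d) _ re≡ with trans (sym (cong re (i*ᵍ (+ suc d) 0ℤ))) re≡
... | ()
unit*fromℕ-re u-i zero 0≢0 _ = ⊥-elim (0≢0 refl)
unit*fromℕ-re u-i (suc d) _ re≡ with trans (sym (cong re (-i*ᵍ (+ suc d) 0ℤ))) re≡
... | ()

uz-unit-multiple : ∀ {u ur D} → IsUnit u → D ≢ 0 → IsUz (u *ᵍ fromℕ D) ur → ur *ᵍ (u *ᵍ fromℕ D) ≡ fromℕ D
uz-unit-multiple {u} {ur} {D} u-unit D≢0 (ur-unit , re-spec , _) =
  trans (*ᵍ-assoc ur u (fromℕ D)) (unit*fromℕ-re (IsUnit-* ur-unit u-unit) D D≢0
    (trans (cong re (sym (*ᵍ-assoc ur u (fromℕ D))))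
           (trans (re-spec ℓ∞≢m) (cong +_ (ℓ∞-unit*fromℕ u-unit D)))))
  where
  ℓ∞≢m : ℓ∞ (u *ᵍ fromℕ D) ≢ mᵍ (u *ᵍ fromℕ D)
  ℓ∞≢m eq = D≢0 (trans (sym (ℓ∞-unit*fromℕ u-unit D)) (trans eq (mᵍ-unit*fromℕ u-unit D)))

∣im∣≤ℓ∞ : ∀ {u} → IsUnit u → ∀ z → ℤ.∣ im (u *ᵍ z) ∣ ℕ.≤ ℓ∞ z
∣im∣≤ℓ∞ u1 z =
  subst (λ t → ℤ.∣ t ∣ ℕ.≤ ℓ∞ z) (sym (cong im (*ᵍ-identityˡ z))) (ℕP.m≤n⊔m ℤ.∣ re z ∣ ℤ.∣ im z ∣)
∣im∣≤ℓ∞ u-1 (x + y i) = subst (λ t → ℤ.∣ t ∣ ℕ.≤ ℓ∞ (x + y i)) (sym (cong im (-1*ᵍ x y)))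
  (subst (ℕ._≤ ℓ∞ (x + y i)) (sym (ℤP.∣-i∣≡∣i∣ y)) (ℕP.m≤n⊔m ℤ.∣ x ∣ ℤ.∣ y ∣))
∣im∣≤ℓ∞ ui (x + y i) =
  subst (λ t → ℤ.∣ t ∣ ℕ.≤ ℓ∞ (x + y i)) (sym (cong im (i*ᵍ x y))) (ℕP.m≤m⊔n ℤ.∣ x ∣ ℤ.∣ y ∣)
∣im∣≤ℓ∞ u-i (x + y i) = subst (λ t → ℤ.∣ t ∣ ℕ.≤ ℓ∞ (x + y i)) (sym (cong im (-i*ᵍ x y)))
  (subst (ℕ._≤ ℓ∞ (x + y i)) (sym (ℤP.∣-i∣≡∣i∣ x)) (ℕP.m≤m⊔n ℤ.∣ x ∣ ℤ.∣ y ∣))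

abs≤⇒bounds : ∀ Y ℓ → ℤ.∣ Y ∣ ℕ.≤ ℓ → - + ℓ ≤ Y × Y ≤ + ℓ
abs≤⇒bounds (+ n) ℓ n≤ℓ = ℤP.neg-≤-pos , +≤+ n≤ℓ
abs≤⇒bounds -[1+ n ] (suc ℓ) (s≤s n≤ℓ) = -≤- n≤ℓ , -≤+

uz-normal-form : ∀ {b ub} → IsUz b ub → Σ ℤ λ Y → ub *ᵍ b ≡ (+ ℓ∞ b) + Y i × - + ℓ∞ b ≤ Y × Y ≤ + ℓ∞ b
uz-normal-form {b} {ub} (ub-unit , re-spec , diag-spec) with ℓ∞ b ℕ.≟ mᵍ b
... | yes ℓ∞≡m = + ℓ∞ b , trans (diag-spec ℓ∞≡m) (ℓ∞*1+i (+ ℓ∞ b)) , ℤP.neg-≤-pos , ℤP.≤-refl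
  where
  ℓ∞*1+i : ∀ t → fromℤ t *ᵍ 1+i ≡ t + t i
  ℓ∞*1+i t = cong₂ _+_i (re≡ t) (im≡ t)
    where
    re≡ : ∀ t → t * + 1 - + 0 * + 1 ≡ t
    re≡ t = solve (t ∷ [])
    im≡ : ∀ t → t * + 1 + + 0 * + 1 ≡ t
    im≡ t = solve (t ∷ [])
... | no ℓ∞≢m = im (ub *ᵍ b) , cong₂ _+_i (re-spec ℓ∞≢m) refl , abs≤⇒bounds _ _ (∣im∣≤ℓ∞ ub-unit b)

Nℤ-unit* : ∀ {u} → IsUnit u → ∀ z → Nℤ (u *ᵍ z) ≡ Nℤ z
Nℤ-unit* {u} u-unit z = trans (Nℤ-*ᵍ u z) (trans (cong (_* Nℤ z) (Nℤ-unit u-unit)) (ℤP.*-identityˡ (Nℤ z)))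
  where
  Nℤ-unit : ∀ {u} → IsUnit u → Nℤ u ≡ + 1
  Nℤ-unit u1 = refl
  Nℤ-unit u-1 = refl
  Nℤ-unit ui = refl
  Nℤ-unit u-i = refl

expansion-norm< : ∀ {n b} → Expansion n b → Nℤ b + + 1 ≤ W n * W (suc n)
expansion-norm< {n} {b} e = octagon-norm<A*B (octagon⇒bounds {n} {re b} {im b} (region⇒octagon (expansion⇒region e)))

Nℤ-scaled : ∀ c D → Nℤ (c *ᵍ fromℤ D) ≡ D * D * Nℤ c
Nℤ-scaled c D = trans (Nℤ-*ᵍ c (fromℤ D)) (reorder (Nℤ c) D)
  where
  reorder : ∀ Nc D → Nc * (D * D + + 0 * + 0) ≡ D * D * Nc
  reorder Nc D = solve (Nc ∷ D ∷ [])

pow2-suc-suc : ∀ k → pow2 (suc (suc k)) ≡ pow2 k + pow2 k + pow2 k + pow2 k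
pow2-suc-suc k = trans (pow2-suc (suc k)) (trans (cong₂ _+_ (pow2-suc k) (pow2-suc k)) (regroup (pow2 k)))
  where
  regroup : ∀ C → (C + C) + (C + C) ≡ C + C + C + C
  regroup C = solve (C ∷ [])

-- From the octagon N(b) ≤ (w (2k+1) - 2)(|x| + |y|) with w (2k+1) = 4 C, and from the remainder
-- bound in the diagonal directions 4 C (|x| + |y|) ≤ N(b).
diagonal-contradiction : ∀ C Nb s → + 1 ≤ C → + 1 ≤ Nb → 0ℤ ≤ s →
  ((C + C) + (C + C)) * s ≤ Nb → Nb ≤ (C + C + C + C - + 2) * s → ⊥
diagonal-contradiction C Nb s 1≤C 1≤Nb 0≤s 4Cs≤Nb Nb≤ =
  nonneg+1≢0 _ (gap 1≤Nb ⊕ gap Nb≤ ⊕ 0≤4C-2 ⊗ gap s≤0) (solve (C ∷ Nb ∷ s ∷ []))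
  where
  0≤4C-2 : 0ℤ ≤ C + C + C + C - + 2
  0≤4C-2 = ≤-by _ (gap 1≤C ⊕ gap 1≤C ⊕ gap 1≤C ⊕ gap 1≤C ⊕ 0≤+ 2) (solve (C ∷ []))
  s≤0 : s ≤ 0ℤ
  s≤0 = double-cancel-≤ s 0ℤ (≤-by _ (gap 4Cs≤Nb ⊕ gap Nb≤) (solve (C ∷ Nb ∷ s ∷ [])))

diagonal-impossible : ∀ k {b u} → b ≢ 0ᵍ → OctagonBounds (suc (twice k)) (re b) (im b) → IsUnit u →
  ¬ HalfBounded² (Nℤ b) (((u *ᵍ 1+i) *ᵍ fromℕ (2 ℕ.^ suc k)) *ᵍ conj b)
diagonal-impossible k {b} {u} b≢0 O u-unit bounded =
  diagonal-contradiction C (Nℤ b) ∣b∣₁ (1≤pow2 k) (1≤Nℤ b≢0) (0≤+ ℤ.∣ re b ∣ ⊕ 0≤+ ℤ.∣ im b ∣) lower upper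
  where
  C = pow2 k
  D = pow2 (suc k)
  ∣b∣₁ = + ℤ.∣ re b ∣ + + ℤ.∣ im b ∣
  regroup : ((u *ᵍ 1+i) *ᵍ fromℤ D) *ᵍ conj b ≡ u *ᵍ ((1+i *ᵍ fromℤ D) *ᵍ conj b)
  regroup = trans (cong (_*ᵍ conj b) (sym (*ᵍ-assoc u 1+i (fromℤ D))))
                  (sym (*ᵍ-assoc u (1+i *ᵍ fromℤ D) (conj b)))
  stripped : HalfBounded² (Nℤ b) ((1+i *ᵍ fromℤ D) *ᵍ conj b)
  stripped = halfBounded²-unit*⁻¹ u-unit (subst (HalfBounded² (Nℤ b)) regroup bounded)
  components : HalfBounded² (Nℤ b) ((D * re b + D * im b) + (D * re b - D * im b) i)
  components = subst (HalfBounded² (Nℤ b)) (diagonal-components D (re b) (im b)) stripped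
  lower : ((C + C) + (C + C)) * ∣b∣₁ ≤ Nℤ b
  lower = subst (λ t → (t + t) * ∣b∣₁ ≤ Nℤ b) (pow2-suc k)
    (diagonal-bound (Nℤ b) D (re b) (im b) (proj₁ components) (proj₂ components))
  upper : Nℤ b ≤ (C + C + C + C - + 2) * ∣b∣₁
  upper = subst (λ A → Nℤ b ≤ (A - + 2) * ∣b∣₁) (W-suc-twice k) (octagon-norm≤ℓ₁ O)

unit-multiple-bound : ∀ {b u} D → IsUnit u → HalfBounded² (Nℤ b) ((u *ᵍ fromℤ D) *ᵍ conj b) →
  (D + D) * + ℓ∞ b ≤ Nℤ b
unit-multiple-bound {b} {u} D u-unit bounded
  with subst (HalfBounded² (Nℤ b)) (scalar-components D (re b) (im b))
         (halfBounded²-unit*⁻¹ u-unit (subst (HalfBounded² (Nℤ b)) (sym (*ᵍ-assoc u (fromℤ D) (conj b))) bounded))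
... | hb-x , hb-y = scalar-bound (Nℤ b) D (re b) (im b) hb-x (halfBounded-neg⁻¹ {Nℤ b} {D * im b} hb-y)

odd-level-norm< : ∀ k {b} → Expansion (suc (twice k)) b →
  Nℤ b + + 1 ≤ (pow2 k + pow2 k + pow2 k + pow2 k) * ((pow2 k + pow2 k + pow2 k) + (pow2 k + pow2 k + pow2 k))
odd-level-norm< k {b} e = subst₂ (λ A B → Nℤ b + + 1 ≤ A * B) (W-suc-twice k) (W-twice-suc k) (expansion-norm< e)

module _ {b c : 𝔾} (v : ℕ) (b≢0 : b ≢ 0ᵍ) (c-odd : Odd𝔾 c)
         (bounded : HalfBounded² (Nℤ b) ((c *ᵍ fromℕ (2 ℕ.^ v)) *ᵍ conj b)) where
  private
    D = pow2 v
    1≤Nc : + 1 ≤ Nℤ c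
    1≤Nc = 1≤Nℤ (Odd𝔾⇒≢0 c-odd)
    2D²Nc≤Nb : D * D * Nℤ c + D * D * Nℤ c ≤ Nℤ b
    2D²Nc≤Nb = halfBounded²-norm {M = D * D * Nℤ c} {z = (c *ᵍ fromℕ (2 ℕ.^ v)) *ᵍ conj b}
      bounded (1≤Nℤ b≢0)
      (trans (Nℤ-*ᵍ (c *ᵍ fromℕ (2 ℕ.^ v)) (conj b)) (cong₂ _*_ (Nℤ-scaled c D) (Nℤ-conj b)))

  even-level-impossible : ∀ k → Expansion (twice k) b → ¬ (fromℕ 2 ^ᵍ v ∣ᵍ fromℕ (wPred (twice k))) → ⊥
  even-level-impossible k e 2^v∤w =
    remainder-too-large C D (Nℤ c) (Nℤ b) (1≤pow2 k) 4C≤D 1≤Nc 2D²Nc≤Nb Nb<24C²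
    where
    C = pow2 k
    k+1<v : suc k ℕ.< v
    k+1<v = 2^v∤m*2^K⇒K<v v (suc k) 1 (subst (λ m → ¬ (fromℕ 2 ^ᵍ v ∣ᵍ fromℕ m)) (wPred-twice k) 2^v∤w)
    4C≤D : C + C + C + C ≤ D
    4C≤D = subst (_≤ D) (pow2-suc-suc k) (pow2-mono {suc (suc k)} {v} k+1<v)
    Nb<12C² : Nℤ b + + 1 ≤ (C + C + C) * (C + C + C + C)
    Nb<12C² = subst₂ (λ A B → Nℤ b + + 1 ≤ A * B) (W-twice k) (W-suc-twice k) (expansion-norm< e)
    Nb<24C² : Nℤ b + + 1 ≤ (C + C + C + C) * ((C + C + C) + (C + C + C))
    Nb<24C² = ℤP.≤-trans Nb<12C² (12C²≤24C² C (1≤pow2 k))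

  odd-level-unit : ∀ k → Expansion (suc (twice k)) b → ¬ (fromℕ 2 ^ᵍ v ∣ᵍ fromℕ (wPred (suc (twice k)))) →
    v ≡ suc k × IsUnit c
  odd-level-unit k e 2^v∤w = [ too-large , exact ]′ (ℕP.m≤n⇒m<n∨m≡n k<v)
    where
    C = pow2 k
    k<v : k ℕ.< v
    k<v = 2^v∤m*2^K⇒K<v v k 3 (subst (λ m → ¬ (fromℕ 2 ^ᵍ v ∣ᵍ fromℕ m)) (wPred-suc-twice k) 2^v∤w)
    Nb<24C² : Nℤ b + + 1 ≤ (C + C + C + C) * ((C + C + C) + (C + C + C))
    Nb<24C² = odd-level-norm< k e
    too-large : suc k ℕ.< v → v ≡ suc k × IsUnit c
    too-large k+1<v = ⊥-elim (remainder-too-large C D (Nℤ c) (Nℤ b) (1≤pow2 k)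
      (subst (_≤ D) (pow2-suc-suc k) (pow2-mono {suc (suc k)} {v} k+1<v)) 1≤Nc 2D²Nc≤Nb Nb<24C²)
    diagonal : suc k ≡ v → Σ 𝔾 (λ u → IsUnit u × c ≡ u *ᵍ 1+i) → IsUnit c
    diagonal k+1≡v (u , u-unit , c≡u*1+i) = ⊥-elim (diagonal-impossible k b≢0
      (octagon⇒bounds {suc (twice k)} {re b} {im b} (region⇒octagon (expansion⇒region e))) u-unit
      (subst₂ (λ c′ v′ → HalfBounded² (Nℤ b) ((c′ *ᵍ fromℕ (2 ℕ.^ v′)) *ᵍ conj b))
              c≡u*1+i (sym k+1≡v) bounded))
    exact : suc k ≡ v → v ≡ suc k × IsUnit c
    exact k+1≡v = sym k+1≡v , [ (λ c-unit → c-unit) , diagonal k+1≡v ]′ (small-odd c-odd Nc≤2)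
      where
      Nc≤2 : Nℤ c ≤ + 2
      Nc≤2 = exact-level⇒norm≤2 C (Nℤ c) (Nℤ b) (1≤pow2 k)
        (subst (λ t → t * t * Nℤ c + t * t * Nℤ c ≤ Nℤ b) (trans (cong pow2 (sym k+1≡v)) (pow2-suc k)) 2D²Nc≤Nb)
        Nb<24C²

  remainder-unit-multiple : ∀ n → Expansion n b → ¬ (fromℕ 2 ^ᵍ v ∣ᵍ fromℕ (wPred n)) →
    Σ ℕ λ k → n ≡ suc (twice k) × v ≡ suc k × IsUnit c
  remainder-unit-multiple n e 2^v∤w with level-parity n
  ... | inj₁ (k , refl) = ⊥-elim (even-level-impossible k e 2^v∤w)
  ... | inj₂ (k , refl) = k , refl , odd-level-unit k e 2^v∤w

-- The next remainder r - (u_b / u_r) b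

*ᵍ-factor : ∀ c d v b → c *ᵍ d -ᵍ (v *ᵍ c) *ᵍ b ≡ c *ᵍ (d -ᵍ v *ᵍ b)
*ᵍ-factor (c₁ + c₂ i) (d₁ + d₂ i) (v₁ + v₂ i) (b₁ + b₂ i) = cong₂ _+_i re≡ im≡
  where
  re≡ : (c₁ * d₁ - c₂ * d₂) + - ((v₁ * c₁ - v₂ * c₂) * b₁ - (v₁ * c₂ + v₂ * c₁) * b₂) ≡
        c₁ * (d₁ + - (v₁ * b₁ - v₂ * b₂)) - c₂ * (d₂ + - (v₁ * b₂ + v₂ * b₁))
  re≡ = solve (c₁ ∷ c₂ ∷ d₁ ∷ d₂ ∷ v₁ ∷ v₂ ∷ b₁ ∷ b₂ ∷ [])
  im≡ : (c₁ * d₂ + c₂ * d₁) + - ((v₁ * c₁ - v₂ * c₂) * b₂ + (v₁ * c₂ + v₂ * c₁) * b₁) ≡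
        c₁ * (d₂ + - (v₁ * b₂ + v₂ * b₁)) + c₂ * (d₁ + - (v₁ * b₁ - v₂ * b₂))
  im≡ = solve (c₁ ∷ c₂ ∷ d₁ ∷ d₂ ∷ v₁ ∷ v₂ ∷ b₁ ∷ b₂ ∷ [])

2C-[L+Yi] : ∀ C L Y → fromℤ (C + C) -ᵍ (L + Y i) ≡ -1ᵍ *ᵍ ((L - (C + C)) + Y i)
2C-[L+Yi] C L Y = cong₂ _+_i re≡ im≡
  where
  re≡ : (C + C) + - L ≡ - + 1 * (L - (C + C)) - + 0 * Y
  re≡ = solve (C ∷ L ∷ Y ∷ [])
  im≡ : + 0 + - Y ≡ - + 1 * Y + + 0 * (L - (C + C))
  im≡ = solve (C ∷ L ∷ Y ∷ [])

next-remainder-level : ∀ {n v k r b ub ur u} → n ≡ suc (twice k) → v ≡ suc k → b ≢ 0ᵍ → Expansion n b →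
  IsUnit u → r ≡ u *ᵍ fromℕ (2 ℕ.^ v) → (pow2 v + pow2 v) * + ℓ∞ b ≤ Nℤ b → IsUz b ub → IsUz r ur →
  mᵍ r ≡ 0 × Σ ℕ (λ p → IsPhi (r -ᵍ (ub *ᵍ conj ur) *ᵍ b) p × p ℕ.< n)
next-remainder-level {k = k} {b = b} {ub} {ur} {u} refl refl b≢0 e u-unit refl 2Dℓ∞≤N
  ub-spec@(ub-unit , _) ur-spec@(ur-unit , _) with uz-normal-form ub-spec
... | Y , ub*b≡ , -L≤Y , Y≤L = mᵍ-unit*fromℕ u-unit D , p , φ , s≤s p≤2k
  where
  open ≡-Reasoning
  D = 2 ℕ.^ suc k
  C = pow2 k
  L = + ℓ∞ b
  r = u *ᵍ fromℕ D
  D≢0 : D ≢ 0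
  D≢0 D≡0 = ℕP.<⇒≢ (ℕP.m^n>0 2 (suc k)) (sym D≡0)
  reached : Region (suc (twice k)) (L + Y i)
  reached = subst (Region _) ub*b≡ (expansion⇒region (expansion-unit* ub-unit e))
  norm≡ : L * L + Y * Y ≡ Nℤ b
  norm≡ = trans (cong Nℤ (sym ub*b≡)) (Nℤ-unit* ub-unit b)
  regroup : ∀ C L → ((C + C) + (C + C)) * L ≡ (C + C + C + C) * L
  regroup C L = solve (C ∷ L ∷ [])
  4CL≤N : (C + C + C + C) * L ≤ L * L + Y * Y
  4CL≤N = subst₂ _≤_ (trans (cong (λ t → (t + t) * L) (pow2-suc k)) (regroup C L)) (sym norm≡) 2Dℓ∞≤N
  shifted = shift-region k L Y reached (λ eq → unit*-≢0 ub-unit b≢0 (trans ub*b≡ eq)) -L≤Y Y≤L 4CL≤N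
  X = (L - (C + C)) + Y i
  next≡ : r -ᵍ (ub *ᵍ conj ur) *ᵍ b ≡ conj ur *ᵍ (-1ᵍ *ᵍ X)
  next≡ = begin
    r -ᵍ (ub *ᵍ conj ur) *ᵍ b
      ≡⟨ cong (_-ᵍ (ub *ᵍ conj ur) *ᵍ b) (sym (unit-cancel ur-unit r)) ⟩
    conj ur *ᵍ (ur *ᵍ r) -ᵍ (ub *ᵍ conj ur) *ᵍ b
      ≡⟨ cong (λ t → conj ur *ᵍ t -ᵍ (ub *ᵍ conj ur) *ᵍ b) (uz-unit-multiple u-unit D≢0 ur-spec) ⟩
    conj ur *ᵍ fromℕ D -ᵍ (ub *ᵍ conj ur) *ᵍ b
      ≡⟨ *ᵍ-factor (conj ur) (fromℕ D) ub b ⟩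
    conj ur *ᵍ (fromℕ D -ᵍ ub *ᵍ b)
      ≡⟨ cong (λ t → conj ur *ᵍ (fromℕ D -ᵍ t)) ub*b≡ ⟩
    conj ur *ᵍ (fromℕ D -ᵍ (L + Y i))
      ≡⟨ cong (λ t → conj ur *ᵍ (fromℤ t -ᵍ (L + Y i))) (pow2-suc k) ⟩
    conj ur *ᵍ (fromℤ (C + C) -ᵍ (L + Y i))
      ≡⟨ cong (conj ur *ᵍ_) (2C-[L+Yi] C L Y) ⟩
    conj ur *ᵍ (-1ᵍ *ᵍ X)
      ∎
  next-expansion : Expansion (twice k) (r -ᵍ (ub *ᵍ conj ur) *ᵍ b)
  next-expansion = subst (Expansion (twice k)) (sym next≡)
    (expansion-unit* (IsUnit-conj ur-unit) (expansion-unit* u-1 (region⇒expansion (proj₁ shifted))))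
  next≢0 : r -ᵍ (ub *ᵍ conj ur) *ᵍ b ≢ 0ᵍ
  next≢0 eq = unit*-≢0 (IsUnit-conj ur-unit) (unit*-≢0 u-1 (proj₂ shifted)) (trans (sym next≡) eq)
  phi = expansion⇒phi next-expansion next≢0
  p = proj₁ phi
  p≤2k = proj₁ (proj₂ phi)
  φ = proj₂ (proj₂ phi)

lemma5 : (a b : 𝔾) → a ≢ 0ᵍ → b ≢ 0ᵍ → gaussRem a b ≢ 0ᵍ
    → (n k : ℕ) → IsPhi b n → IsPhi (gaussRem a b) k → n ℕ.≤ k
    → (v : ℕ) → IsV2 (gaussRem a b) v → ¬ ((fromℕ 2 ^ᵍ v) ∣ᵍ fromℕ (wPred n))
    → (ub ur : 𝔾) → IsUz b ub → IsUz (gaussRem a b) ur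
    → (mᵍ (gaussRem a b) ≡ 0)
    × Σ ℕ (λ p → IsPhi (gaussRem a b -ᵍ (ub *ᵍ conj ur) *ᵍ b) p × p ℕ.< n)
lemma5 a b _ b≢0 _ n _ (b-digits , _) _ _ v v₂ 2^v∤w ub ur ub-spec ur-spec =
  let c , r≡c2^v , c-odd = odd-part {gaussRem a b} {v} v₂
      bounded = subst (λ r → HalfBounded² (Nℤ b) (r *ᵍ conj b)) r≡c2^v (gaussRem-halfBounded a b b≢0)
      k , n≡ , v≡ , c-unit = remainder-unit-multiple {b} {c} v b≢0 c-odd bounded n b-expansion 2^v∤w
  in next-remainder-level {k = k} n≡ v≡ b≢0 b-expansion c-unit r≡c2^v
       (unit-multiple-bound {b} {c} (pow2 v) c-unit bounded) ub-spec ur-spec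
  where
  b-expansion = hasExp⇒expansion b-digits
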